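{- Let $f(\mathbf{A}_1,\dots,\mathbf{A}_s)$ be a matrix formula and $\mathbf{N}$ the matrix constructed for it as described in the context. Suppose the formula contains $r$ inversion gates and $\mathbf{B}_1,\dots,\mathbf{B}_r$ are the inputs (the matrices being inverted) of these inversion gates. Then $|\det(\mathbf{N})|=\prod_{i=1}^r|\det(\mathbf{B}_i)|$.
   Context: A matrix formula is a rooted tree whose leaves (input gates) are the input matrices (each used once) and whose internal nodes are addition, subtraction, multiplication (two children) or inversion (one child). Notation: $\mathbf{I}^{(n)}$ is the $n\times n$ identity; $\mathbf{I}^{(n)}_{[n],J}$ its columns indexed by $J$, $\mathbf{I}^{(n)}_{I,[n]}$ its rows indexed by $I$. $\mathbf{N}$ and index sets $I,J$ are defined recursively: (input) leaf $\mathbf{A}\in\mathbb{R}^{n_A\times m_A}$: $\mathbf{N}=\begin{bmatrix}\mathbf{I}^{(n_A)}&\mathbf{A}\\ \mathbf{0}&-\mathbf{I}^{(m_A)}\end{bmatrix}$, $I=\{1,\dots,n_A\}$, $J=\{n_A+1,\dots,n_A+m_A\}$. (inversion) child construction $\mathbf{N}'$ ($n'\times n'$), sets $I',J'$ of size $n_w$: $\mathbf{N}=\begin{bmatrix}\mathbf{N}'&-\mathbf{I}^{(n')}_{[n'],J'}\\ \mathbf{I}^{(n')}_{I',[n']}&\mathbf{0}\end{bmatrix}$, $I=J=\{n'+1,\dots,n'+n_w\}$. (addition/subtraction) children constructions $\mathbf{L}$ ($n_L\times n_L$; $I_L,J_L$), $\mathbf{R}$ ($n_R\times n_R$; $I_R,J_R$),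 $|I_L|=|I_R|=n_w$, $|J_L|=|J_R|=m_w$: $\mathbf{N}=\begin{bmatrix}\mathbf{L}&\mathbf{0}&\mathbf{I}^{(n_L)}_{[n_L],J_L}&\mathbf{0}\\ \mathbf{0}&\mathbf{R}&\pm\mathbf{I}^{(n_R)}_{[n_R],J_R}&\mathbf{0}\\ \mathbf{I}^{(n_L)}_{I_L,[n_L]}&\mathbf{I}^{(n_R)}_{I_R,[n_R]}&\mathbf{0}&\mathbf{I}^{(n_w)}\\ \mathbf{0}&\mathbf{0}&\mathbf{I}^{(m_w)}&\mathbf{0}\end{bmatrix}$ ($+$ for addition, $-$ for subtraction; block column widths $n_L,n_R,m_w,n_w$), $I$ = last $n_w$ indices, $J$ = last $m_w$ indices. (multiplication) $\mathbf{N}=\begin{bmatrix}\mathbf{L}&-\mathbf{I}^{(n_L)}_{[n_L],J_L}\mathbf{I}^{(n_R)}_{I_R,[n_R]}\\ \mathbf{0}&\mathbf{R}\end{bmatrix}$, $I=I_L$, $J=\{n_L+j:j\in J_R\}$. When all inversions are well defined, $\mathbf{N}$ is invertible and $(\mathbf{N}^{ -1})_{I,J}$ equals the value of the formula. -}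

module Defs where

open import Level using (Level; _⊔_)
open import Algebra.Bundles using (CommutativeRing)
open import Data.Nat using (ℕ; zero; suc) renaming (_+_ to _+ℕ_)
open import Data.Nat.Properties using (+-comm)
open import Data.Fin using (Fin; zero; suc; splitAt; cast; _↑ˡ_; _↑ʳ_; punchIn; _≟_)
open import Data.Sum using (_⊎_; inj₁; inj₂; [_,_]′)
open import Data.Bool using (if_then_else_)
open import Relation.Nullary using (does)
open import Relation.Binary.PropositionalEquality using (_≡_; cong)

-- Everything is parameterised by a commutative ring of scalars
-- (the paper works over ℝ).
module MatrixFormulas {c ℓ : Level} (𝓡 : CommutativeRing c ℓ) where

  open CommutativeRing 𝓡 using (Carrier; _≈_; _+_; _*_; -_; _-_; 0#; 1#)

  Matrix : ℕ → ℕ → Set c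
  Matrix a b = Fin a → Fin b → Carrier

  _≈ᴹ_ : ∀ {a b} → Matrix a b → Matrix a b → Set ℓ
  A ≈ᴹ B = ∀ i j → A i j ≈ B i j

  ∑ : ∀ {k} → (Fin k → Carrier) → Carrier
  ∑ {zero}  f = 0#
  ∑ {suc k} f = f zero + ∑ (λ i → f (suc i))

  𝟎 : ∀ {a b} → Matrix a b
  𝟎 _ _ = 0#

  𝟏 : ∀ {n} → Matrix n n
  𝟏 i j = if does (i ≟ j) then 1# else 0#

  _⊕_ : ∀ {a b} → Matrix a b → Matrix a b → Matrix a b
  (A ⊕ B) i j = A i j + B i j

  _⊖_ : ∀ {a b} → Matrix a b → Matrix a b → Matrix a b
  (A ⊖ B) i j = A i j - B i j

  _⊗_ : ∀ {a b d} → Matrix a b → Matrix b d → Matrix a d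
  (A ⊗ B) i j = ∑ (λ k → A i k * B k j)

  neg : ∀ {a b} → Matrix a b → Matrix a b
  neg A i j = - A i j

  -- I^(n)_{[n],J}: the columns of I^(n) indexed by J (J given as an injection Fin w → Fin n)
  colsOf : ∀ {n w} → (Fin w → Fin n) → Matrix n w
  colsOf J a b = if does (a ≟ J b) then 1# else 0#

  -- I^(n)_{I,[n]}: the rows of I^(n) indexed by I
  rowsOf : ∀ {n w} → (Fin w → Fin n) → Matrix w n
  rowsOf I b a = if does (a ≟ I b) then 1# else 0#

  hcat : ∀ {a b d} → Matrix a b → Matrix a d → Matrix a (b +ℕ d)
  hcat {b = b} A B i j = [ A i , B i ]′ (splitAt b j)

  vcat : ∀ {a b d} → Matrix a d → Matrix b d → Matrix (a +ℕ b) d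
  vcat {a = a} A B i j = [ (λ i' → A i' j) , (λ i' → B i' j) ]′ (splitAt a i)

  alt : ℕ → Carrier → Carrier
  alt zero    x = x
  alt (suc k) x = - alt k x

  altF : ∀ {n} → Fin n → Carrier → Carrier
  altF zero    x = x
  altF (suc j) x = - altF j x

  minor : ∀ {n} → Matrix (suc n) (suc n) → Fin (suc n) → Matrix n n
  minor M j a b = M (suc a) (punchIn j b)

  det : ∀ {n} → Matrix n n → Carrier
  det {zero}  M = 1#
  det {suc n} M = ∑ (λ j → altF j (M zero j * det (minor M j)))

  -- Matrix formulas.  Leaves carry the input matrices themselves, so
  -- each input is used exactly once.  Formula n m has an n × m value.
  data Formula : ℕ → ℕ → Set c where
    input : ∀ {n m} → Matrix n m → Formula n m
    inv   : ∀ {n} → Formula n n → Formula n n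
    add   : ∀ {n m} → Formula n m → Formula n m → Formula n m
    sub   : ∀ {n m} → Formula n m → Formula n m → Formula n m
    mul   : ∀ {n k m} → Formula n k → Formula k m → Formula n m

  -- Evaluation, when all inversions are well defined: Eval f V means that
  -- f evaluates to V, every inversion gate being applied to an invertible
  -- matrix B and returning its (two-sided) inverse.
  data Eval : ∀ {n m} → Formula n m → Matrix n m → Set (c ⊔ ℓ) where
    input : ∀ {n m} (A : Matrix n m) → Eval (input A) A
    inv   : ∀ {n} {f : Formula n n} {B V : Matrix n n} →
            Eval f B → (B ⊗ V) ≈ᴹ 𝟏 → (V ⊗ B) ≈ᴹ 𝟏 → Eval (inv f) V
    add   : ∀ {n m} {f g : Formula n m} {A B : Matrix n m} →
            Eval f A → Eval g B → Eval (add f g) (A ⊕ B)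
    sub   : ∀ {n m} {f g : Formula n m} {A B : Matrix n m} →
            Eval f A → Eval g B → Eval (sub f g) (A ⊖ B)
    mul   : ∀ {n k m} {f : Formula n k} {g : Formula k m} {A : Matrix n k} {B : Matrix k m} →
            Eval f A → Eval g B → Eval (mul f g) (A ⊗ B)

  invDetProd : ∀ {n m} {f : Formula n m} {V : Matrix n m} → Eval f V → Carrier
  invDetProd (input A)               = 1#
  invDetProd (inv {B = B} e _ _)     = det B * invDetProd e
  invDetProd (add e e')              = invDetProd e * invDetProd e'
  invDetProd (sub e e')              = invDetProd e * invDetProd e'
  invDetProd (mul e e')              = invDetProd e * invDetProd e'

  record Construction (n m : ℕ) : Set c where
    field
      size : ℕ
      N    : Matrix size size
      I    : Fin n → Fin size
      J    : Fin m → Fin size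

  open Construction

  -- addition / subtraction block, sign given by s (1# or -1#)
  -- rows ordered  nL, nR, n_w, m_w ; columns ordered nL, nR, m_w, n_w
  addBlock : ∀ {n m} → Carrier → Construction n m → Construction n m → Construction n m
  addBlock {n} {m} s L R = record
    { size = sL +ℕ (sR +ℕ (n +ℕ m))
    ; N    = λ i j → M i (cast eq j)
    ; I    = λ i → sL ↑ʳ (sR ↑ʳ cast (+-comm m n) (m ↑ʳ i))
    ; J    = λ j → sL ↑ʳ (sR ↑ʳ (n ↑ʳ j))
    }
    where
      sL = size L
      sR = size R
      eq : sL +ℕ (sR +ℕ (n +ℕ m)) ≡ sL +ℕ (sR +ℕ (m +ℕ n))
      eq = cong (λ t → sL +ℕ (sR +ℕ t)) (+-comm n m)
      C = sR +ℕ (m +ℕ n)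
      rowL : Matrix sL (sL +ℕ C)
      rowL = hcat (N L) (hcat (𝟎 {sL} {sR}) (hcat (colsOf (J L)) (𝟎 {sL} {n})))
      rowR : Matrix sR (sL +ℕ C)
      rowR = hcat (𝟎 {sR} {sL}) (hcat (N R) (hcat (λ a b → s * colsOf (J R) a b) (𝟎 {sR} {n})))
      rowI : Matrix n (sL +ℕ C)
      rowI = hcat (rowsOf (I L)) (hcat (rowsOf (I R)) (hcat (𝟎 {n} {m}) 𝟏))
      rowJ : Matrix m (sL +ℕ C)
      rowJ = hcat (𝟎 {m} {sL}) (hcat (𝟎 {m} {sR}) (hcat 𝟏 (𝟎 {m} {n})))
      M : Matrix (sL +ℕ (sR +ℕ (n +ℕ m))) (sL +ℕ (sR +ℕ (m +ℕ n)))
      M = vcat rowL (vcat rowR (vcat rowI rowJ))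

  construct : ∀ {n m} → Formula n m → Construction n m
  construct {n} {m} (input A) = record
    { size = n +ℕ m
    ; N    = vcat (hcat 𝟏 A) (hcat 𝟎 (neg 𝟏))
    ; I    = λ i → i ↑ˡ m
    ; J    = λ j → n ↑ʳ j
    }
  construct {n} (inv f) = record
    { size = size C +ℕ n
    ; N    = vcat (hcat (N C) (neg (colsOf (J C)))) (hcat (rowsOf (I C)) 𝟎)
    ; I    = λ i → size C ↑ʳ i
    ; J    = λ j → size C ↑ʳ j
    }
    where C = construct f
  construct (add f g) = addBlock 1# (construct f) (construct g)
  construct (sub f g) = addBlock (- 1#) (construct f) (construct g)
  construct (mul f g) = record
    { size = size L +ℕ size R
    ; N    = vcat (hcat (N L) (neg (colsOf (J L) ⊗ rowsOf (I R)))) (hcat 𝟎 (N R))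
    ; I    = λ i → I L i ↑ˡ size R
    ; J    = λ j → size L ↑ʳ J R j
    }
    where
      L = construct f
      R = construct g

{-# OPTIONS --safe #-}
module Submission where

-- Over an arbitrary commutative ring nothing can be inverted, so instead of N⁻¹ the induction
-- on the evaluation carries a matrix X with N X = I_{[n],J} whose I-rows are the value of the
-- formula.  Each construction step is a block matrix whose determinant factors: input and
-- multiplication gates are block upper triangular; at an inversion gate with input B,
-- eliminating the upper right block with X leaves the Schur complement B, so det N = det N′ · det B;
-- at an addition gate the identity blocks eliminate the off-diagonal entries, leaving
-- det N_L · det N_R times the determinant ±1 of a block-swap permutation.  The block formulas
-- rest on multiplicativity of det, which follows from the uniqueness of alternating
-- multilinear forms, proved from the Laplace expansion.

open import Defs
open import Level using (Level; _⊔_)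
open import Algebra.Bundles using (CommutativeRing)
open import Data.Nat using (ℕ)
open import Data.Sum using (_⊎_)

module FormulaDeterminant {c ℓ : Level} (𝓡 : CommutativeRing c ℓ) where

  open import Data.Nat using (zero; suc; pred) renaming (_+_ to _+ℕ_)
  open import Data.Fin using (Fin; zero; suc; cast; _↑ˡ_; _↑ʳ_; splitAt; join; punchIn; punchOut; _≟_)
  open import Data.Fin.Properties
    using (punchInᵢ≢i; punchIn-punchOut; suc-injective; splitAt-↑ˡ; splitAt-↑ʳ; splitAt⁻¹-↑ˡ; splitAt⁻¹-↑ʳ;
           toℕ-injective; toℕ-cast; toℕ-↑ˡ; toℕ-↑ʳ; ↑ˡ-injective; ↑ʳ-injective; punchIn-injective; punchOut-injective;
           cast-involutive; splitAt-join; join-splitAt)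
  open import Data.Sum using (inj₁; inj₂)
  import Data.Sum as ⊎
  open import Data.Sum.Properties using (swap-involutive)
  import Data.Nat.Properties as ℕ
  open import Data.Vec.Functional using (_∷_; tail; insertAt; removeAt; updateAt)
  open import Data.Vec.Functional.Properties using (insertAt-lookup; insertAt-punchIn; updateAt-updates; updateAt-minimal)
  open import Function using (_∘_; const)
  open import Relation.Nullary using (Dec; yes; no; contradiction)
  open import Relation.Nullary.Decidable using (dec-true; dec-false)
  open import Relation.Binary.Bundles using (Setoid)
  import Data.Vec.Functional.Relation.Binary.Equality.Setoid as VecEq
  open import Relation.Binary.PropositionalEquality as ≡ using (_≡_; _≢_)

  open CommutativeRing 𝓡 hiding (zero)
  open import Algebra.Properties.Ring ring
    using (-‿involutive; -0#≈0#; -‿+-comm; -‿distribˡ-*; -‿distribʳ-*; -1*x≈-x; +-inverseʳ-unique)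
  open import Algebra.Properties.CommutativeSemigroup *-commutativeSemigroup using (x∙yz≈y∙xz)
  import Algebra.Properties.Semiring.Sum semiring as Sum
  open import Relation.Binary.Reasoning.Setoid setoid
  open MatrixFormulas 𝓡

  infix 4 _≈±_

  _≈±_ : Carrier → Carrier → Set ℓ
  x ≈± y = x ≈ y ⊎ x ≈ - y

  ≈±-respˡ : ∀ {x x′ y} → x ≈ x′ → x′ ≈± y → x ≈± y
  ≈±-respˡ x≈x′ (inj₁ p) = inj₁ (trans x≈x′ p)
  ≈±-respˡ x≈x′ (inj₂ p) = inj₂ (trans x≈x′ p)

  -‿≈± : ∀ {x y} → x ≈± y → - x ≈± y
  -‿≈± (inj₁ p) = inj₂ (-‿cong p)
  -‿≈± (inj₂ p) = inj₁ (trans (-‿cong p) (-‿involutive _))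

  ≈±-trans : ∀ {x y z} → x ≈± y → y ≈± z → x ≈± z
  ≈±-trans (inj₁ p) q = ≈±-respˡ p q
  ≈±-trans (inj₂ p) q = ≈±-respˡ p (-‿≈± q)

  *-≈± : ∀ {x x′ y y′} → x ≈± y → x′ ≈± y′ → x * x′ ≈± y * y′
  *-≈± (inj₁ p) (inj₁ q) = inj₁ (*-cong p q)
  *-≈± (inj₁ p) (inj₂ q) = inj₂ (trans (*-cong p q) (sym (-‿distribʳ-* _ _)))
  *-≈± (inj₂ p) (inj₁ q) = inj₂ (trans (*-cong p q) (sym (-‿distribˡ-* _ _)))
  *-≈± {x} {x′} {y} {y′} (inj₂ p) (inj₂ q) = inj₁ (begin
    x * x′        ≈⟨ *-cong p q ⟩
    - y * - y′    ≈⟨ -‿distribˡ-* y (- y′) ⟨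
    - (y * - y′)  ≈⟨ -‿cong (-‿distribʳ-* y y′) ⟨
    - - (y * y′)  ≈⟨ -‿involutive (y * y′) ⟩
    y * y′        ∎)

  ∑≈sum : ∀ {k} (f : Fin k → Carrier) → ∑ f ≈ Sum.sum f
  ∑≈sum {zero}  f = refl
  ∑≈sum {suc k} f = +-congˡ (∑≈sum (f ∘ suc))

  ∑-cong : ∀ {k} {f g : Fin k → Carrier} → (∀ i → f i ≈ g i) → ∑ f ≈ ∑ g
  ∑-cong {f = f} {g} f≈g = begin
    ∑ f       ≈⟨ ∑≈sum f ⟩
    Sum.sum f ≈⟨ Sum.sum-cong-≋ f≈g ⟩
    Sum.sum g ≈⟨ ∑≈sum g ⟨
    ∑ g       ∎

  ∑-zero : ∀ {k} {f : Fin k → Carrier} → (∀ i → f i ≈ 0#) → ∑ f ≈ 0#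
  ∑-zero {k} f≈0 = trans (∑-cong f≈0) (trans (∑≈sum {k} (λ _ → 0#)) (Sum.sum-replicate-zero k))

  ∑-distrib-+ : ∀ {k} (f g : Fin k → Carrier) → ∑ (λ i → f i + g i) ≈ ∑ f + ∑ g
  ∑-distrib-+ f g = begin
    ∑ (λ i → f i + g i)       ≈⟨ ∑≈sum (λ i → f i + g i) ⟩
    Sum.sum (λ i → f i + g i) ≈⟨ Sum.∑-distrib-+ f g ⟩
    Sum.sum f + Sum.sum g     ≈⟨ +-cong (∑≈sum f) (∑≈sum g) ⟨
    ∑ f + ∑ g                 ∎

  *-distribˡ-∑ : ∀ {k} x (f : Fin k → Carrier) → x * ∑ f ≈ ∑ (λ i → x * f i)
  *-distribˡ-∑ x f = begin
    x * ∑ f                   ≈⟨ *-congˡ (∑≈sum f) ⟩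
    x * Sum.sum f             ≈⟨ Sum.*-distribˡ-sum x f ⟩
    Sum.sum (λ i → x * f i)   ≈⟨ ∑≈sum (λ i → x * f i) ⟨
    ∑ (λ i → x * f i)         ∎

  *-distribʳ-∑ : ∀ {k} x (f : Fin k → Carrier) → ∑ f * x ≈ ∑ (λ i → f i * x)
  *-distribʳ-∑ x f = begin
    ∑ f * x                   ≈⟨ *-congʳ (∑≈sum f) ⟩
    Sum.sum f * x             ≈⟨ Sum.*-distribʳ-sum x f ⟩
    Sum.sum (λ i → f i * x)   ≈⟨ ∑≈sum (λ i → f i * x) ⟨
    ∑ (λ i → f i * x)         ∎

  -‿∑ : ∀ {k} (f : Fin k → Carrier) → - ∑ f ≈ ∑ (λ i → - f i)
  -‿∑ f = begin
    - ∑ f                ≈⟨ -1*x≈-x _ ⟨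
    - 1# * ∑ f           ≈⟨ *-distribˡ-∑ (- 1#) f ⟩
    ∑ (λ i → - 1# * f i) ≈⟨ ∑-cong (λ i → -1*x≈-x (f i)) ⟩
    ∑ (λ i → - f i)      ∎

  ∑-comm : ∀ {a b} (f : Fin a → Fin b → Carrier) →
           ∑ (λ i → ∑ (λ j → f i j)) ≈ ∑ (λ j → ∑ (λ i → f i j))
  ∑-comm f = begin
    ∑ (λ i → ∑ (λ j → f i j))           ≈⟨ ∑-cong (λ i → ∑≈sum (f i)) ⟩
    ∑ (λ i → Sum.sum (f i))             ≈⟨ ∑≈sum (λ i → Sum.sum (f i)) ⟩
    Sum.sum (λ i → Sum.sum (f i))       ≈⟨ Sum.∑-comm f ⟩
    Sum.sum (λ j → Sum.sum (λ i → f i j)) ≈⟨ ∑≈sum (λ j → Sum.sum (λ i → f i j)) ⟨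
    ∑ (λ j → Sum.sum (λ i → f i j))     ≈⟨ ∑-cong (λ j → ∑≈sum (λ i → f i j)) ⟨
    ∑ (λ j → ∑ (λ i → f i j))           ∎

  ∑-single : ∀ {k} (j : Fin k) {f : Fin k → Carrier} → (∀ i → i ≢ j → f i ≈ 0#) → ∑ f ≈ f j
  ∑-single {suc k} j {f} f≈0 = begin
    ∑ f                                   ≈⟨ ∑≈sum f ⟩
    Sum.sum f                             ≈⟨ Sum.sum-remove f ⟩
    f j + Sum.sum (f ∘ punchIn j)         ≈⟨ +-congˡ (∑≈sum (f ∘ punchIn j)) ⟨
    f j + ∑ (f ∘ punchIn j)               ≈⟨ +-congˡ (∑-zero (λ i → f≈0 (punchIn j i) (punchInᵢ≢i j i))) ⟩
    f j + 0#                              ≈⟨ +-identityʳ (f j) ⟩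
    f j                                   ∎

  ∑-split : ∀ a {b} (f : Fin (a +ℕ b) → Carrier) →
            ∑ f ≈ ∑ (λ i → f (i ↑ˡ b)) + ∑ (λ i → f (a ↑ʳ i))
  ∑-split zero    f = sym (+-identityˡ _)
  ∑-split (suc a) f = trans (+-congˡ (∑-split a (f ∘ suc))) (sym (+-assoc _ _ _))

  ∑-linear : ∀ {k} x {f g h : Fin k → Carrier} → (∀ i → f i ≈ x * g i + h i) → ∑ f ≈ x * ∑ g + ∑ h
  ∑-linear x {f} {g} {h} f≈ = begin
    ∑ f                             ≈⟨ ∑-cong f≈ ⟩
    ∑ (λ i → x * g i + h i)         ≈⟨ ∑-distrib-+ (λ i → x * g i) h ⟩
    ∑ (λ i → x * g i) + ∑ h         ≈⟨ +-congʳ (*-distribˡ-∑ x g) ⟨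
    x * ∑ g + ∑ h                   ∎

  -- Antisymmetry alone would only give 2 · ∑ = 0; the diagonal is handled separately.
  ∑∑-antisymmetric : ∀ {n} (t : Fin n → Fin n → Carrier) → (∀ j → t j j ≈ 0#) → (∀ j l → t j l ≈ - t l j) →
                     ∑ (λ j → ∑ (λ l → t j l)) ≈ 0#
  ∑∑-antisymmetric {zero}  t diag anti = refl
  ∑∑-antisymmetric {suc n} t diag anti = begin
    (t zero zero + ∑ (λ l → t zero (suc l))) + ∑ (λ j → t (suc j) zero + ∑ (λ l → t (suc j) (suc l)))
      ≈⟨ +-cong (+-congʳ (diag zero)) (∑-distrib-+ (λ j → t (suc j) zero) (λ j → ∑ (λ l → t (suc j) (suc l)))) ⟩
    (0# + ∑ (λ l → t zero (suc l))) + (∑ (λ j → t (suc j) zero) + ∑ (λ j → ∑ (λ l → t (suc j) (suc l))))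
      ≈⟨ +-cong (+-identityˡ _)
                (+-congˡ (∑∑-antisymmetric (λ j l → t (suc j) (suc l)) (diag ∘ suc) (λ j l → anti (suc j) (suc l)))) ⟩
    ∑ (λ l → t zero (suc l)) + (∑ (λ j → t (suc j) zero) + 0#)
      ≈⟨ +-congˡ (+-identityʳ _) ⟩
    ∑ (λ l → t zero (suc l)) + ∑ (λ j → t (suc j) zero)
      ≈⟨ ∑-distrib-+ (λ l → t zero (suc l)) (λ j → t (suc j) zero) ⟨
    ∑ (λ l → t zero (suc l) + t (suc l) zero)
      ≈⟨ ∑-zero (λ l → trans (+-congʳ (anti zero (suc l))) (-‿inverseˡ _)) ⟩
    0# ∎

  ∑-cast : ∀ {a b} .(eq : a ≡ b) (f : Fin b → Carrier) → ∑ (f ∘ cast eq) ≈ ∑ f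
  ∑-cast {zero}  {zero}  eq f = refl
  ∑-cast {suc a} {suc b} eq f = +-congˡ (∑-cast {a} {b} (≡.cong pred eq) (f ∘ suc))

  𝟏-≡ : ∀ {n} {i j : Fin n} → i ≡ j → 𝟏 i j ≈ 1#
  𝟏-≡ {i = i} {j} i≡j rewrite dec-true (i ≟ j) i≡j = refl

  𝟏-diag : ∀ {n} (i : Fin n) → 𝟏 i i ≈ 1#
  𝟏-diag i = 𝟏-≡ {i = i} {i} ≡.refl

  𝟏-≢ : ∀ {n} {i j : Fin n} → i ≢ j → 𝟏 i j ≈ 0#
  𝟏-≢ {i = i} {j} i≢j rewrite dec-false (i ≟ j) i≢j = refl

  𝟏-resp : ∀ {n n′} {i j : Fin n} {i′ j′ : Fin n′} →
           (i ≡ j → i′ ≡ j′) → (i′ ≡ j′ → i ≡ j) → 𝟏 i j ≈ 𝟏 i′ j′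
  𝟏-resp {i = i} {j} {i′} {j′} to from = by (i ≟ j)
    where
    by : Dec (i ≡ j) → 𝟏 i j ≈ 𝟏 i′ j′
    by (yes i≡j) = trans (𝟏-≡ i≡j) (sym (𝟏-≡ (to i≡j)))
    by (no  i≢j) = trans (𝟏-≢ i≢j) (sym (𝟏-≢ (i≢j ∘ from)))

  𝟏-sym : ∀ {n} (i j : Fin n) → 𝟏 i j ≈ 𝟏 j i
  𝟏-sym i j = 𝟏-resp {i = i} {j} {j} {i} ≡.sym ≡.sym

  ∑-δˡ : ∀ {n} (j : Fin n) (f : Fin n → Carrier) → ∑ (λ k → 𝟏 k j * f k) ≈ f j
  ∑-δˡ j f = begin
    ∑ (λ k → 𝟏 k j * f k) ≈⟨ ∑-single j (λ k k≢j → trans (*-congʳ (𝟏-≢ k≢j)) (zeroˡ (f k))) ⟩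
    𝟏 j j * f j           ≈⟨ *-congʳ (𝟏-diag j) ⟩
    1# * f j              ≈⟨ *-identityˡ (f j) ⟩
    f j                   ∎

  ∑-δʳ : ∀ {n} (j : Fin n) (f : Fin n → Carrier) → ∑ (λ k → f k * 𝟏 k j) ≈ f j
  ∑-δʳ j f = trans (∑-cong (λ k → *-comm (f k) (𝟏 k j))) (∑-δˡ j f)

  ≈ᴹ-setoid : ℕ → ℕ → Setoid c ℓ
  ≈ᴹ-setoid a b = VecEq.≋-setoid (VecEq.≋-setoid setoid b) a

  module ≈ᴹ {a b : ℕ} = Setoid (≈ᴹ-setoid a b)

  ⊗-cong : ∀ {a b d} {A A′ : Matrix a b} {B B′ : Matrix b d} → A ≈ᴹ A′ → B ≈ᴹ B′ → (A ⊗ B) ≈ᴹ (A′ ⊗ B′)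
  ⊗-cong A≈A′ B≈B′ i j = ∑-cong (λ k → *-cong (A≈A′ i k) (B≈B′ k j))

  ⊕-cong : ∀ {a b} {A A′ B B′ : Matrix a b} → A ≈ᴹ A′ → B ≈ᴹ B′ → (A ⊕ B) ≈ᴹ (A′ ⊕ B′)
  ⊕-cong A≈A′ B≈B′ i j = +-cong (A≈A′ i j) (B≈B′ i j)

  neg-cong : ∀ {a b} {A A′ : Matrix a b} → A ≈ᴹ A′ → neg A ≈ᴹ neg A′
  neg-cong A≈A′ i j = -‿cong (A≈A′ i j)

  ⊗-assoc : ∀ {a b d e} (A : Matrix a b) (B : Matrix b d) (C : Matrix d e) → ((A ⊗ B) ⊗ C) ≈ᴹ (A ⊗ (B ⊗ C))
  ⊗-assoc A B C i j = begin
    ∑ (λ k → ∑ (λ l → A i l * B l k) * C k j)   ≈⟨ ∑-cong (λ k → *-distribʳ-∑ (C k j) (λ l → A i l * B l k)) ⟩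
    ∑ (λ k → ∑ (λ l → A i l * B l k * C k j))   ≈⟨ ∑-comm (λ k l → A i l * B l k * C k j) ⟩
    ∑ (λ l → ∑ (λ k → A i l * B l k * C k j))   ≈⟨ ∑-cong (λ l → ∑-cong (λ k → *-assoc (A i l) (B l k) (C k j))) ⟩
    ∑ (λ l → ∑ (λ k → A i l * (B l k * C k j))) ≈⟨ ∑-cong (λ l → *-distribˡ-∑ (A i l) (λ k → B l k * C k j)) ⟨
    ∑ (λ l → A i l * ∑ (λ k → B l k * C k j))   ∎

  ⊗-identityˡ : ∀ {a b} (A : Matrix a b) → (𝟏 ⊗ A) ≈ᴹ A
  ⊗-identityˡ A i j = trans (∑-cong (λ k → *-congʳ (𝟏-sym i k))) (∑-δˡ i (λ k → A k j))

  ⊗-identityʳ : ∀ {a b} (A : Matrix a b) → (A ⊗ 𝟏) ≈ᴹ A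
  ⊗-identityʳ A i j = ∑-δʳ j (A i)

  ⊗-zeroˡ : ∀ {a b d} (A : Matrix b d) → (𝟎 {a} ⊗ A) ≈ᴹ 𝟎
  ⊗-zeroˡ A i j = ∑-zero (λ k → zeroˡ (A k j))

  ⊗-zeroʳ : ∀ {a b d} (A : Matrix a b) → (A ⊗ 𝟎 {b} {d}) ≈ᴹ 𝟎
  ⊗-zeroʳ A i j = ∑-zero (λ k → zeroʳ (A i k))

  ⊗-negˡ : ∀ {a b d} (A : Matrix a b) (B : Matrix b d) → (neg A ⊗ B) ≈ᴹ neg (A ⊗ B)
  ⊗-negˡ A B i j = trans (∑-cong (λ k → sym (-‿distribˡ-* (A i k) (B k j)))) (sym (-‿∑ (λ k → A i k * B k j)))

  ⊗-negʳ : ∀ {a b d} (A : Matrix a b) (B : Matrix b d) → (A ⊗ neg B) ≈ᴹ neg (A ⊗ B)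
  ⊗-negʳ A B i j = trans (∑-cong (λ k → sym (-‿distribʳ-* (A i k) (B k j)))) (sym (-‿∑ (λ k → A i k * B k j)))

  rowsOf-⊗ : ∀ {n w d} (I : Fin w → Fin n) (X : Matrix n d) → (rowsOf I ⊗ X) ≈ᴹ (λ i j → X (I i) j)
  rowsOf-⊗ I X i j = ∑-δˡ (I i) (λ k → X k j)

  ⊕-cancel : ∀ {a b} {A B : Matrix a b} → A ≈ᴹ B → (neg A ⊕ B) ≈ᴹ 𝟎
  ⊕-cancel A≈B i j = trans (+-congˡ (sym (A≈B i j))) (-‿inverseˡ _)

  ⊕-cancelʳ : ∀ {a b} {A B : Matrix a b} → A ≈ᴹ B → (A ⊕ neg B) ≈ᴹ 𝟎
  ⊕-cancelʳ A≈B i j = trans (+-congʳ (A≈B i j)) (-‿inverseʳ _)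

  ⊕-identityˡ : ∀ {a b} {Z A : Matrix a b} → Z ≈ᴹ 𝟎 → (Z ⊕ A) ≈ᴹ A
  ⊕-identityˡ Z≈0 i j = trans (+-congʳ (Z≈0 i j)) (+-identityˡ _)

  ⊕-identityʳ : ∀ {a b} {A Z : Matrix a b} → Z ≈ᴹ 𝟎 → (A ⊕ Z) ≈ᴹ A
  ⊕-identityʳ Z≈0 i j = trans (+-congˡ (Z≈0 i j)) (+-identityʳ _)

  -- Block matrices

  hcat-↑ˡ : ∀ {a b d} (A : Matrix a b) (B : Matrix a d) i j → hcat A B i (j ↑ˡ d) ≡ A i j
  hcat-↑ˡ {b = b} {d} A B i j rewrite splitAt-↑ˡ b j d = ≡.refl

  hcat-↑ʳ : ∀ {a b d} (A : Matrix a b) (B : Matrix a d) i j → hcat A B i (b ↑ʳ j) ≡ B i j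
  hcat-↑ʳ {b = b} {d} A B i j rewrite splitAt-↑ʳ b d j = ≡.refl

  vcat-↑ˡ : ∀ {a b d} (A : Matrix a d) (B : Matrix b d) i j → vcat A B (i ↑ˡ b) j ≡ A i j
  vcat-↑ˡ {a} {b} A B i j rewrite splitAt-↑ˡ a i b = ≡.refl

  vcat-↑ʳ : ∀ {a b d} (A : Matrix a d) (B : Matrix b d) i j → vcat A B (a ↑ʳ i) j ≡ B i j
  vcat-↑ʳ {a} {b} A B i j rewrite splitAt-↑ʳ a b i = ≡.refl

  ↑-elim : ∀ a b {p} (P : Fin (a +ℕ b) → Set p) → (∀ i → P (i ↑ˡ b)) → (∀ i → P (a ↑ʳ i)) → ∀ k → P k
  ↑-elim a b P left right k with splitAt a k in eq
  ... | inj₁ i = ≡.subst P (splitAt⁻¹-↑ˡ eq) (left i)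
  ... | inj₂ i = ≡.subst P (splitAt⁻¹-↑ʳ eq) (right i)

  ≈ᴹ-columnwise : ∀ {a d e} {M M′ : Matrix a (d +ℕ e)} →
                  (∀ i j → M i (j ↑ˡ e) ≈ M′ i (j ↑ˡ e)) → (∀ i j → M i (d ↑ʳ j) ≈ M′ i (d ↑ʳ j)) → M ≈ᴹ M′
  ≈ᴹ-columnwise {d = d} {e} {M} {M′} left right i =
    ↑-elim d e (λ j → M i j ≈ M′ i j) (left i) (right i)

  ≈ᴹ-rowwise : ∀ {a b d} {M M′ : Matrix (a +ℕ b) d} →
               (∀ i j → M (i ↑ˡ b) j ≈ M′ (i ↑ˡ b) j) → (∀ i j → M (a ↑ʳ i) j ≈ M′ (a ↑ʳ i) j) → M ≈ᴹ M′
  ≈ᴹ-rowwise {a} {b} {M = M} {M′} = ↑-elim a b (λ i → ∀ j → M i j ≈ M′ i j)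

  hcat-cong : ∀ {a b d} {A A′ : Matrix a b} {B B′ : Matrix a d} → A ≈ᴹ A′ → B ≈ᴹ B′ → hcat A B ≈ᴹ hcat A′ B′
  hcat-cong {b = b} A≈A′ B≈B′ i j with splitAt b j
  ... | inj₁ j′ = A≈A′ i j′
  ... | inj₂ j′ = B≈B′ i j′

  vcat-cong : ∀ {a b d} {A A′ : Matrix a d} {B B′ : Matrix b d} → A ≈ᴹ A′ → B ≈ᴹ B′ → vcat A B ≈ᴹ vcat A′ B′
  vcat-cong {a} A≈A′ B≈B′ i j with splitAt a i
  ... | inj₁ i′ = A≈A′ i′ j
  ... | inj₂ i′ = B≈B′ i′ j

  vcat-hcat-interchange : ∀ {a b d e} (A : Matrix a d) (B : Matrix a e) (C : Matrix b d) (D : Matrix b e) →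
                          vcat (hcat A B) (hcat C D) ≈ᴹ hcat (vcat A C) (vcat B D)
  vcat-hcat-interchange {a} {d = d} A B C D i j with splitAt a i | splitAt d j
  ... | inj₁ i′ | inj₁ j′ = refl
  ... | inj₁ i′ | inj₂ j′ = refl
  ... | inj₂ i′ | inj₁ j′ = refl
  ... | inj₂ i′ | inj₂ j′ = refl

  hcat-⊕ : ∀ {a b d} (A C : Matrix a b) (B D : Matrix a d) → (hcat A B ⊕ hcat C D) ≈ᴹ hcat (A ⊕ C) (B ⊕ D)
  hcat-⊕ {b = b} A C B D i j with splitAt b j
  ... | inj₁ j′ = refl
  ... | inj₂ j′ = refl

  vcat-⊕ : ∀ {a b d} (A C : Matrix a d) (B D : Matrix b d) → (vcat A B ⊕ vcat C D) ≈ᴹ vcat (A ⊕ C) (B ⊕ D)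
  vcat-⊕ {a} A C B D i j with splitAt a i
  ... | inj₁ i′ = refl
  ... | inj₂ i′ = refl

  vcat-⊗ : ∀ {a b d e} (A : Matrix a d) (B : Matrix b d) (X : Matrix d e) → (vcat A B ⊗ X) ≈ᴹ vcat (A ⊗ X) (B ⊗ X)
  vcat-⊗ {a} A B X i j with splitAt a i
  ... | inj₁ i′ = refl
  ... | inj₂ i′ = refl

  ⊗-hcat : ∀ {a b d e} (X : Matrix a b) (A : Matrix b d) (B : Matrix b e) → (X ⊗ hcat A B) ≈ᴹ hcat (X ⊗ A) (X ⊗ B)
  ⊗-hcat {d = d} X A B i j with splitAt d j
  ... | inj₁ j′ = refl
  ... | inj₂ j′ = refl

  hcat-⊗-vcat : ∀ {a b d e} (A : Matrix a b) (B : Matrix a d) (C : Matrix b e) (D : Matrix d e) →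
                (hcat A B ⊗ vcat C D) ≈ᴹ ((A ⊗ C) ⊕ (B ⊗ D))
  hcat-⊗-vcat {b = b} A B C D i j = trans (∑-split b _) (+-cong
    (∑-cong (λ k → reflexive (≡.cong₂ _*_ (hcat-↑ˡ A B i k) (vcat-↑ˡ C D k j))))
    (∑-cong (λ k → reflexive (≡.cong₂ _*_ (hcat-↑ʳ A B i k) (vcat-↑ʳ C D k j)))))

  block : ∀ {a b d e} → Matrix a d → Matrix a e → Matrix b d → Matrix b e → Matrix (a +ℕ b) (d +ℕ e)
  block A B C D = vcat (hcat A B) (hcat C D)

  block-cong : ∀ {a b d e} {A A′ : Matrix a d} {B B′ : Matrix a e} {C C′ : Matrix b d} {D D′ : Matrix b e} →
               A ≈ᴹ A′ → B ≈ᴹ B′ → C ≈ᴹ C′ → D ≈ᴹ D′ → block A B C D ≈ᴹ block A′ B′ C′ D′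
  block-cong A≈ B≈ C≈ D≈ = vcat-cong (hcat-cong A≈ B≈) (hcat-cong C≈ D≈)

  block-⊗-vcat : ∀ {a b d e f} (A : Matrix a d) (B : Matrix a e) (C : Matrix b d) (D : Matrix b e)
                 (E : Matrix d f) (G : Matrix e f) →
                 (block A B C D ⊗ vcat E G) ≈ᴹ vcat ((A ⊗ E) ⊕ (B ⊗ G)) ((C ⊗ E) ⊕ (D ⊗ G))
  block-⊗-vcat A B C D E G =
    ≈ᴹ.trans (vcat-⊗ (hcat A B) (hcat C D) (vcat E G)) (vcat-cong (hcat-⊗-vcat A B E G) (hcat-⊗-vcat C D E G))

  block-⊗-block : ∀ {a b d e f g} (A : Matrix a d) (B : Matrix a e) (C : Matrix b d) (D : Matrix b e)
                  (E : Matrix d f) (F : Matrix d g) (G : Matrix e f) (H : Matrix e g) →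
                  (block A B C D ⊗ block E F G H) ≈ᴹ
                  block ((A ⊗ E) ⊕ (B ⊗ G)) ((A ⊗ F) ⊕ (B ⊗ H)) ((C ⊗ E) ⊕ (D ⊗ G)) ((C ⊗ F) ⊕ (D ⊗ H))
  block-⊗-block A B C D E F G H =
    ≈ᴹ.trans (vcat-⊗ (hcat A B) (hcat C D) _) (vcat-cong (row A B) (row C D))
    where
    row : ∀ {r} (P : Matrix r _) (Q : Matrix r _) →
          (hcat P Q ⊗ block E F G H) ≈ᴹ hcat ((P ⊗ E) ⊕ (Q ⊗ G)) ((P ⊗ F) ⊕ (Q ⊗ H))
    row P Q = ≈ᴹ.trans (hcat-⊗-vcat P Q (hcat E F) (hcat G H))
              (≈ᴹ.trans (⊕-cong (⊗-hcat P E F) (⊗-hcat Q G H)) (hcat-⊕ (P ⊗ E) (Q ⊗ G) (P ⊗ F) (Q ⊗ H)))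


  ↑ˡ≢↑ʳ : ∀ {a b} (i : Fin a) (j : Fin b) → i ↑ˡ b ≢ a ↑ʳ j
  ↑ˡ≢↑ʳ {a} {b} i j eq
    with ≡.trans (≡.sym (splitAt-↑ˡ a i b)) (≡.trans (≡.cong (splitAt a) eq) (splitAt-↑ʳ a b j))
  ... | ()

  𝟏-↑ˡ-↑ˡ : ∀ {a} b (i j : Fin a) → 𝟏 (i ↑ˡ b) (j ↑ˡ b) ≈ 𝟏 i j
  𝟏-↑ˡ-↑ˡ b i j = 𝟏-resp (↑ˡ-injective b i j) (≡.cong (_↑ˡ b))

  𝟏-↑ʳ-↑ʳ : ∀ a {b} (i j : Fin b) → 𝟏 (a ↑ʳ i) (a ↑ʳ j) ≈ 𝟏 i j
  𝟏-↑ʳ-↑ʳ a i j = 𝟏-resp (↑ʳ-injective a i j) (≡.cong (a ↑ʳ_))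

  colsOf-↑ʳ : ∀ a {b w} (J : Fin w → Fin b) → colsOf (λ j → a ↑ʳ J j) ≈ᴹ vcat 𝟎 (colsOf J)
  colsOf-↑ʳ a {b} J = ≈ᴹ-rowwise
    (λ i j → trans (𝟏-≢ (↑ˡ≢↑ʳ i (J j))) (reflexive (≡.sym (vcat-↑ˡ (𝟎 {a}) (colsOf J) i j))))
    (λ i j → trans (𝟏-↑ʳ-↑ʳ a i (J j)) (reflexive (≡.sym (vcat-↑ʳ (𝟎 {a}) (colsOf J) i j))))

  rowsOf-↑ˡ : ∀ {a} b {w} (I : Fin w → Fin a) → rowsOf (λ i → I i ↑ˡ b) ≈ᴹ hcat (rowsOf I) 𝟎
  rowsOf-↑ˡ b I = ≈ᴹ-columnwise
    (λ i j → trans (𝟏-↑ˡ-↑ˡ b j (I i)) (reflexive (≡.sym (hcat-↑ˡ (rowsOf I) 𝟎 i j))))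
    (λ i j → trans (𝟏-≢ (↑ˡ≢↑ʳ (I i) j ∘ ≡.sym)) (reflexive (≡.sym (hcat-↑ʳ (rowsOf I) 𝟎 i j))))

  rowsOf-↑ʳ : ∀ a {b w} (I : Fin w → Fin b) → rowsOf (λ i → a ↑ʳ I i) ≈ᴹ hcat 𝟎 (rowsOf I)
  rowsOf-↑ʳ a I = ≈ᴹ-columnwise
    (λ i j → trans (𝟏-≢ (↑ˡ≢↑ʳ j (I i))) (reflexive (≡.sym (hcat-↑ˡ {b = a} 𝟎 (rowsOf I) i j))))
    (λ i j → trans (𝟏-↑ʳ-↑ʳ a j (I i)) (reflexive (≡.sym (hcat-↑ʳ {b = a} 𝟎 (rowsOf I) i j))))

  𝟏-punchIn : ∀ {n} {p q : Fin (suc n)} (p≢q : p ≢ q) (b : Fin n) → 𝟏 (punchIn p b) q ≈ 𝟏 b (punchOut p≢q)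
  𝟏-punchIn {p = p} p≢q b = 𝟏-resp
    (λ eq → punchIn-injective p b _ (≡.trans eq (≡.sym (punchIn-punchOut p≢q))))
    (λ eq → ≡.trans (≡.cong (punchIn p) eq) (punchIn-punchOut p≢q))

  punchIn-punchOut-comm : ∀ {n} (j l : Fin (suc (suc n))) (j≢l : j ≢ l) (l≢j : l ≢ j) (b : Fin n) →
                          punchIn j (punchIn (punchOut j≢l) b) ≡ punchIn l (punchIn (punchOut l≢j) b)
  punchIn-punchOut-comm zero          zero    j≢l _   b       = contradiction ≡.refl j≢l
  punchIn-punchOut-comm zero          (suc l) _   _   b       = ≡.refl
  punchIn-punchOut-comm (suc j)       zero    _   _   b       = ≡.refl
  punchIn-punchOut-comm {suc n} (suc j) (suc l) _   _   zero    = ≡.refl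
  punchIn-punchOut-comm {suc n} (suc j) (suc l) j≢l l≢j (suc b) =
    ≡.cong suc (punchIn-punchOut-comm j l (j≢l ∘ ≡.cong suc) (l≢j ∘ ≡.cong suc) b)

  castCols : ∀ {a b b′} → .(b′ ≡ b) → Matrix a b → Matrix a b′
  castCols eq A i j = A i (cast eq j)

  castRows : ∀ {a a′ b} → .(a′ ≡ a) → Matrix a b → Matrix a′ b
  castRows eq A i j = A (cast eq i) j

  castCols-⊗-castRows : ∀ {a b b′ d} .(eq : b′ ≡ b) (A : Matrix a b) (B : Matrix b d) →
                        (castCols eq A ⊗ castRows eq B) ≈ᴹ (A ⊗ B)
  castCols-⊗-castRows eq A B i j = ∑-cast eq (λ k → A i k * B k j)

  castCols-cong : ∀ {a b b′} .(eq : b′ ≡ b) {A A′ : Matrix a b} → A ≈ᴹ A′ → castCols eq A ≈ᴹ castCols eq A′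
  castCols-cong eq A≈A′ i j = A≈A′ i (cast eq j)

  cast-↑ˡ : ∀ {d e e′} .(eq : d +ℕ e ≡ d +ℕ e′) (j : Fin d) → cast eq (j ↑ˡ e) ≡ j ↑ˡ e′
  cast-↑ˡ {e = e} {e′} eq j =
    toℕ-injective (≡.trans (toℕ-cast eq (j ↑ˡ e)) (≡.trans (toℕ-↑ˡ j e) (≡.sym (toℕ-↑ˡ j e′))))

  cast-↑ʳ : ∀ d {e e′} .(eq : d +ℕ e ≡ d +ℕ e′) .(eq′ : e ≡ e′) (k : Fin e) → cast eq (d ↑ʳ k) ≡ d ↑ʳ cast eq′ k
  cast-↑ʳ d eq eq′ k = toℕ-injective (≡.trans (toℕ-cast eq (d ↑ʳ k)) (≡.trans (toℕ-↑ʳ d k)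
    (≡.sym (≡.trans (toℕ-↑ʳ d (cast eq′ k)) (≡.cong (d +ℕ_) (toℕ-cast eq′ k))))))

  castCols-hcat : ∀ {a d e e′} .(eq : d +ℕ e ≡ d +ℕ e′) .(eq′ : e ≡ e′) (A : Matrix a d) (B : Matrix a e′) →
                  castCols eq (hcat A B) ≈ᴹ hcat A (castCols eq′ B)
  castCols-hcat {d = d} eq eq′ A B = ≈ᴹ-columnwise
    (λ i j → reflexive (≡.trans (≡.cong (hcat A B i) (cast-↑ˡ eq j))
                         (≡.trans (hcat-↑ˡ A B i j) (≡.sym (hcat-↑ˡ A (castCols eq′ B) i j)))))
    (λ i k → reflexive (≡.trans (≡.cong (hcat A B i) (cast-↑ʳ d eq eq′ k))
                         (≡.trans (hcat-↑ʳ A B i (cast eq′ k)) (≡.sym (hcat-↑ʳ A (castCols eq′ B) i k)))))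

  castCols-hcat₂ : ∀ {r a b t t′} .(eq : a +ℕ (b +ℕ t) ≡ a +ℕ (b +ℕ t′)) .(eq′ : t ≡ t′)
                   (P : Matrix r a) (Q : Matrix r b) (T : Matrix r t′) →
                   castCols eq (hcat P (hcat Q T)) ≈ᴹ hcat P (hcat Q (castCols eq′ T))
  castCols-hcat₂ {b = b} {t} eq eq′ P Q T =
    ≈ᴹ.trans (castCols-hcat {e = b +ℕ t} eq (≡.cong (b +ℕ_) eq′) P (hcat Q T))
             (hcat-cong {A = P} {P} ≈ᴹ.refl (castCols-hcat {e = t} (≡.cong (b +ℕ_) eq′) eq′ Q T))

  castCols-rowsOf : ∀ {a b w} .(eq : a ≡ b) (I : Fin w → Fin b) →
                    castCols eq (rowsOf I) ≈ᴹ rowsOf (cast (≡.sym eq) ∘ I)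
  castCols-rowsOf eq I i j = 𝟏-resp
    (λ e → ≡.trans (≡.sym (cast-involutive (≡.sym eq) eq j)) (≡.cong (cast (≡.sym eq)) e))
    (λ e → ≡.trans (≡.cong (cast eq) e) (cast-involutive eq (≡.sym eq) (I i)))

  rowsOf-↑ˡ-⊗-vcat : ∀ {a b w d} (I : Fin w → Fin a) (A : Matrix a d) (B : Matrix b d) →
                     (rowsOf (λ i → I i ↑ˡ b) ⊗ vcat A B) ≈ᴹ (rowsOf I ⊗ A)
  rowsOf-↑ˡ-⊗-vcat {b = b} I A B =
    ≈ᴹ.trans (⊗-cong (rowsOf-↑ˡ b I) ≈ᴹ.refl) (≈ᴹ.trans (hcat-⊗-vcat (rowsOf I) 𝟎 A B) (⊕-identityʳ (⊗-zeroˡ B)))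

  rowsOf-↑ʳ-⊗-vcat : ∀ {a b w d} (I : Fin w → Fin b) (A : Matrix a d) (B : Matrix b d) →
                     (rowsOf (λ i → a ↑ʳ I i) ⊗ vcat A B) ≈ᴹ (rowsOf I ⊗ B)
  rowsOf-↑ʳ-⊗-vcat {a} I A B =
    ≈ᴹ.trans (⊗-cong (rowsOf-↑ʳ a I) ≈ᴹ.refl) (≈ᴹ.trans (hcat-⊗-vcat 𝟎 (rowsOf I) A B) (⊕-identityˡ (⊗-zeroˡ A)))

  scale : ∀ {a b} → Carrier → Matrix a b → Matrix a b
  scale s A i j = s * A i j

  scale-cong : ∀ {a b} s {A B : Matrix a b} → A ≈ᴹ B → scale s A ≈ᴹ scale s B
  scale-cong s A≈B i j = *-congˡ (A≈B i j)

  ⊗-scaleʳ : ∀ {a b d} s (A : Matrix a b) (B : Matrix b d) → (A ⊗ scale s B) ≈ᴹ scale s (A ⊗ B)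
  ⊗-scaleʳ s A B i j = trans (∑-cong (λ k → x∙yz≈y∙xz (A i k) s (B k j))) (sym (*-distribˡ-∑ s (λ k → A i k * B k j)))

  -- Multilinear and alternating forms

  AgreeOff : ∀ {k m} → Fin k → Matrix k m → Matrix k m → Set ℓ
  AgreeOff r X Y = ∀ i → i ≢ r → ∀ j → X i j ≈ Y i j

  agreeOff-zero : ∀ {k m} {X Y : Matrix (suc k) m} → (∀ a j → X (suc a) j ≈ Y (suc a) j) → AgreeOff zero X Y
  agreeOff-zero tail≈ zero    0≢0 = contradiction ≡.refl 0≢0
  agreeOff-zero tail≈ (suc a) _   = tail≈ a

  record IsMultilinear {k m} (F : Matrix k m → Carrier) : Set (c ⊔ ℓ) where
    field
      cong   : ∀ {X Y} → X ≈ᴹ Y → F X ≈ F Y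
      linear : ∀ r x {X Y Z} → AgreeOff r X Y → AgreeOff r X Z →
               (∀ j → X r j ≈ x * Y r j + Z r j) → F X ≈ x * F Y + F Z

    additive : ∀ r {X Y Z} → AgreeOff r X Y → AgreeOff r X Z → (∀ j → X r j ≈ Y r j + Z r j) → F X ≈ F Y + F Z
    additive r X~Y X~Z Xr≈ = trans (linear r 1# X~Y X~Z (λ j → trans (Xr≈ j) (+-congʳ (sym (*-identityˡ _)))))
                                   (+-congʳ (*-identityˡ _))

    zero-row : ∀ r {X} → (∀ j → X r j ≈ 0#) → F X ≈ 0#
    zero-row r {X} Xr≈0 = begin
      F X              ≈⟨ linear r (- 1#) (λ _ _ _ → refl) (λ _ _ _ → refl) (λ j → trans (Xr≈0 j) (sym (-1*y+y≈0 (X r j)))) ⟩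
      - 1# * F X + F X ≈⟨ -1*y+y≈0 (F X) ⟩
      0#               ∎
      where
      -1*y+y≈0 : ∀ y → - 1# * y + y ≈ 0#
      -1*y+y≈0 y = trans (+-congʳ (-1*x≈-x y)) (-‿inverseˡ y)

  record IsAlternatingForm {n} (F : Matrix n n → Carrier) : Set (c ⊔ ℓ) where
    field
      isMultilinear : IsMultilinear F
      alternating   : ∀ X {r s} → r ≢ s → (∀ j → X r j ≈ X s j) → F X ≈ 0#

    open IsMultilinear isMultilinear public

  infixl 6 _[_]≔_

  _[_]≔_ : ∀ {k m} → Matrix k m → Fin k → (Fin m → Carrier) → Matrix k m
  X [ r ]≔ v = updateAt X r (const v)

  []≔-updates : ∀ {k m} (X : Matrix k m) r v j → (X [ r ]≔ v) r j ≡ v j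
  []≔-updates X r v j = ≡.cong-app (updateAt-updates r X) j

  []≔-minimal : ∀ {k m} (X : Matrix k m) {r i} v → i ≢ r → ∀ j → (X [ r ]≔ v) i j ≡ X i j
  []≔-minimal X {r} {i} v i≢r j = ≡.cong-app (updateAt-minimal i r X i≢r) j

  linear-∑ : ∀ {k m} {F : Matrix k m → Carrier} → IsMultilinear F →
             ∀ {p} r X (cs : Fin p → Carrier) (Ys : Fin p → Matrix k m) → (∀ l → AgreeOff r X (Ys l)) →
             (∀ j → X r j ≈ ∑ (λ l → cs l * Ys l r j)) → F X ≈ ∑ (λ l → cs l * F (Ys l))
  linear-∑             F-lin {zero}  r X cs Ys X~Ys Xr≈ = IsMultilinear.zero-row F-lin r Xr≈
  linear-∑ {k} {m} {F} F-lin {suc p} r X cs Ys X~Ys Xr≈ = begin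
    F X                                 ≈⟨ linear r (cs zero) (X~Ys zero) X~Z
                                             (λ j → trans (Xr≈ j) (+-congˡ (reflexive (≡.sym ([]≔-updates X r rest j))))) ⟩
    cs zero * F (Ys zero) + F Z         ≈⟨ +-congˡ (linear-∑ F-lin r Z (cs ∘ suc) (Ys ∘ suc) Z~Ys
                                             (λ j → reflexive ([]≔-updates X r rest j))) ⟩
    cs zero * F (Ys zero) + ∑ (λ l → cs (suc l) * F (Ys (suc l))) ∎
    where
    open IsMultilinear F-lin
    rest : Fin m → Carrier
    rest j = ∑ (λ l → cs (suc l) * Ys (suc l) r j)
    Z : Matrix k m
    Z = X [ r ]≔ rest
    X~Z : AgreeOff r X Z
    X~Z i i≢r j = reflexive (≡.sym ([]≔-minimal X rest i≢r j))
    Z~Ys : ∀ l → AgreeOff r Z (Ys (suc l))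
    Z~Ys l i i≢r j = trans (reflexive ([]≔-minimal X rest i≢r j)) (X~Ys (suc l) i i≢r j)

  ∷-isMultilinear : ∀ {k m} {F : Matrix (suc k) m → Carrier} (v : Fin m → Carrier) →
                    IsMultilinear F → IsMultilinear (λ Y → F (v ∷ Y))
  ∷-isMultilinear v F-lin = record
    { cong   = λ X≈Y → cong (λ { zero j → refl ; (suc a) j → X≈Y a j })
    ; linear = λ r x X~Y X~Z Xr≈ → linear (suc r) x (lift X~Y) (lift X~Z) Xr≈
    }
    where
    open IsMultilinear F-lin
    lift : ∀ {r X Y} → AgreeOff r X Y → AgreeOff (suc r) (v ∷ X) (v ∷ Y)
    lift X~Y zero    _     j = refl
    lift X~Y (suc i) i≢r j = X~Y i (i≢r ∘ ≡.cong suc) j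

  addMultiples-invariant : ∀ {k m} {Φ : Matrix k m → Carrier} (w : Fin m → Carrier) → IsMultilinear Φ →
                           (∀ Y a → (∀ j → Y a j ≈ w j) → Φ Y ≈ 0#) →
                           ∀ Y (d : Fin k → Carrier) → Φ (λ a j → Y a j + d a * w j) ≈ Φ Y
  addMultiples-invariant {zero}          w Φ-lin vanish Y d = IsMultilinear.cong Φ-lin (λ ())
  addMultiples-invariant {suc k} {m} {Φ} w Φ-lin vanish Y d = begin
    Φ Y′                                   ≈⟨ linear zero (d zero) (agreeOff-zero (λ _ _ → refl)) (agreeOff-zero (λ _ _ → refl))
                                                (λ j → +-comm _ _) ⟩
    d zero * Φ (w ∷ tail Y′) + Φ (Y zero ∷ tail Y′) ≈⟨ +-congʳ (trans (*-congˡ (vanish (w ∷ tail Y′) zero (λ _ → refl))) (zeroʳ _)) ⟩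
    0# + Φ (Y zero ∷ tail Y′)              ≈⟨ +-identityˡ _ ⟩
    Φ (Y zero ∷ tail Y′)                   ≈⟨ addMultiples-invariant w (∷-isMultilinear (Y zero) Φ-lin)
                                                (λ Z a → vanish (Y zero ∷ Z) (suc a)) (tail Y) (tail d) ⟩
    Φ (Y zero ∷ tail Y)                    ≈⟨ cong (λ { zero j → refl ; (suc a) j → refl }) ⟩
    Φ Y                                    ∎
    where
    open IsMultilinear Φ-lin
    Y′ : Matrix (suc k) m
    Y′ a j = Y a j + d a * w j

  record RowSwap {k m} (r s : Fin k) (X Y : Matrix k m) : Set ℓ where
    field
      at-r   : ∀ j → Y r j ≈ X s j
      at-s   : ∀ j → Y s j ≈ X r j
      others : ∀ i → i ≢ r → i ≢ s → ∀ j → Y i j ≈ X i j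

  rows-cases : ∀ {k p} (r s : Fin k) (P : Fin k → Set p) → P r → P s → (∀ i → i ≢ r → i ≢ s → P i) → ∀ i → P i
  rows-cases r s P Pr Ps Pi i with i ≟ r | i ≟ s
  ... | yes ≡.refl | _          = Pr
  ... | no  i≢r    | yes ≡.refl = Ps
  ... | no  i≢r    | no  i≢s    = Pi i i≢r i≢s

  []≔[]≔-r : ∀ {k m} (X : Matrix k m) {r s} u v → r ≢ s → ∀ j → (X [ r ]≔ u [ s ]≔ v) r j ≡ u j
  []≔[]≔-r X {r} {s} u v r≢s j = ≡.trans ([]≔-minimal (X [ r ]≔ u) v r≢s j) ([]≔-updates X r u j)

  []≔[]≔-s : ∀ {k m} (X : Matrix k m) {r s} u v → ∀ j → (X [ r ]≔ u [ s ]≔ v) s j ≡ v j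
  []≔[]≔-s X {r} {s} u v = []≔-updates (X [ r ]≔ u) s v

  []≔[]≔-others : ∀ {k m} (X : Matrix k m) {r s i} u v → i ≢ r → i ≢ s → ∀ j → (X [ r ]≔ u [ s ]≔ v) i j ≡ X i j
  []≔[]≔-others X {r} {s} u v i≢r i≢s j = ≡.trans ([]≔-minimal (X [ r ]≔ u) v i≢s j) ([]≔-minimal X u i≢r j)

  swapRows-RowSwap : ∀ {k m} (X : Matrix k m) {r s} → r ≢ s → RowSwap r s X (X [ r ]≔ X s [ s ]≔ X r)
  swapRows-RowSwap X {r} {s} r≢s = record
    { at-r   = λ j → reflexive ([]≔[]≔-r X (X s) (X r) r≢s j)
    ; at-s   = λ j → reflexive ([]≔[]≔-s X (X s) (X r) j)
    ; others = λ i i≢r i≢s j → reflexive ([]≔[]≔-others X (X s) (X r) i≢r i≢s j)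
    }

  rowSwap-negates : ∀ {n} {F : Matrix n n → Carrier} → IsAlternatingForm F →
                    ∀ {r s X Y} → r ≢ s → RowSwap r s X Y → F Y ≈ - F X
  rowSwap-negates {n} {F} F-alt {r} {s} {X} {Y} r≢s swap = begin
    F Y                 ≈⟨ cong (T≈ (sym ∘ at-r) (sym ∘ at-s) (λ i i≢r i≢s j → sym (others i i≢r i≢s j))) ⟨
    F (T (X s) (X r))   ≈⟨ +-inverseʳ-unique _ _ (swaps-cancel (X r) (X s)) ⟩
    - F (T (X r) (X s)) ≈⟨ -‿cong (cong (T≈ (λ _ → refl) (λ _ → refl) (λ _ _ _ _ → refl))) ⟩
    - F X               ∎
    where
    open IsAlternatingForm F-alt
    open RowSwap swap
    T : (Fin n → Carrier) → (Fin n → Carrier) → Matrix n n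
    T u v = X [ r ]≔ u [ s ]≔ v
    T-r : ∀ u v j → T u v r j ≡ u j
    T-r u v = []≔[]≔-r X u v r≢s
    T-s : ∀ u v j → T u v s j ≡ v j
    T-s = []≔[]≔-s X
    T-others : ∀ u v i → i ≢ r → i ≢ s → ∀ j → T u v i j ≡ X i j
    T-others u v i = []≔[]≔-others X u v
    T≈ : ∀ {Z u v} → (∀ j → u j ≈ Z r j) → (∀ j → v j ≈ Z s j) → (∀ i → i ≢ r → i ≢ s → ∀ j → X i j ≈ Z i j) →
         T u v ≈ᴹ Z
    T≈ {Z} {u} {v} u≈ v≈ X≈ = rows-cases r s (λ i → ∀ j → T u v i j ≈ Z i j)
      (λ j → trans (reflexive (T-r u v j)) (u≈ j)) (λ j → trans (reflexive (T-s u v j)) (v≈ j))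
      (λ i i≢r i≢s j → trans (reflexive (T-others u v i i≢r i≢s j)) (X≈ i i≢r i≢s j))
    agree-r : ∀ u u′ v → AgreeOff r (T u v) (T u′ v)
    agree-r u u′ v = rows-cases r s (λ i → i ≢ r → ∀ j → T u v i j ≈ T u′ v i j)
      (λ r≢r → contradiction ≡.refl r≢r) (λ _ j → reflexive (≡.trans (T-s u v j) (≡.sym (T-s u′ v j))))
      (λ i i≢r i≢s _ j → reflexive (≡.trans (T-others u v i i≢r i≢s j) (≡.sym (T-others u′ v i i≢r i≢s j))))
    agree-s : ∀ u v v′ → AgreeOff s (T u v) (T u v′)
    agree-s u v v′ i i≢s j =
      reflexive (≡.trans ([]≔-minimal (X [ r ]≔ u) v i≢s j) (≡.sym ([]≔-minimal (X [ r ]≔ u) v′ i≢s j)))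
    T-equal : ∀ u → F (T u u) ≈ 0#
    T-equal u = alternating (T u u) r≢s (λ j → reflexive (≡.trans (T-r u u j) (≡.sym (T-s u u j))))
    swaps-cancel : ∀ u v → F (T u v) + F (T v u) ≈ 0#
    swaps-cancel u v = begin
      F (T u v) + F (T v u)                             ≈⟨ +-cong (+-identityˡ _) (+-identityʳ _) ⟨
      (0# + F (T u v)) + (F (T v u) + 0#)               ≈⟨ +-cong (+-congʳ (T-equal u)) (+-congˡ (T-equal v)) ⟨
      (F (T u u) + F (T u v)) + (F (T v u) + F (T v v)) ≈⟨ +-cong (split-s u) (split-s v) ⟨
      F (T u w) + F (T v w)                             ≈⟨ additive r (agree-r w u w) (agree-r w v w)
                                                             (λ j → reflexive (≡.trans (T-r w w j) (≡.sym
                                                               (≡.cong₂ _+_ (T-r u w j) (T-r v w j))))) ⟨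
      F (T w w)                                         ≈⟨ T-equal w ⟩
      0#                                                ∎
      where
      w : Fin n → Carrier
      w j = u j + v j
      split-s : ∀ a → F (T a w) ≈ F (T a u) + F (T a v)
      split-s a = additive s (agree-s a w u) (agree-s a w v)
        (λ j → reflexive (≡.trans (T-s a w j) (≡.sym (≡.cong₂ _+_ (T-s a u j) (T-s a v j)))))

  record IsRowLinear {a n} (Φ : Matrix a a → Matrix n n) : Set (c ⊔ ℓ) where
    field
      position           : Fin a → Fin n
      position-injective : ∀ {r s} → position r ≡ position s → r ≡ s
      rowMap             : (Fin a → Carrier) → Fin n → Carrier
      rowMap-cong        : ∀ {u v} → (∀ j → u j ≈ v j) → ∀ k → rowMap u k ≈ rowMap v k
      rowMap-linear      : ∀ x u v k → rowMap (λ j → x * u j + v j) k ≈ x * rowMap u k + rowMap v k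
      row                : ∀ X r k → Φ X (position r) k ≈ rowMap (X r) k
      agreeOff           : ∀ {r X Y} → AgreeOff r X Y → AgreeOff (position r) (Φ X) (Φ Y)
      cong               : ∀ {X Y} → X ≈ᴹ Y → Φ X ≈ᴹ Φ Y

  ∘-isAlternatingForm : ∀ {a n} {F : Matrix n n → Carrier} {Φ : Matrix a a → Matrix n n} →
                        IsAlternatingForm F → IsRowLinear Φ → IsAlternatingForm (F ∘ Φ)
  ∘-isAlternatingForm {F = F} {Φ} F-alt Φ-lin = record
    { isMultilinear = record
      { cong   = F.cong ∘ cong
      ; linear = λ r x {X} {Y} {Z} X~Y X~Z Xr≈ → F.linear (position r) x (agreeOff X~Y) (agreeOff X~Z) λ k → begin
          Φ X (position r) k                          ≈⟨ row X r k ⟩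
          rowMap (X r) k                              ≈⟨ rowMap-cong Xr≈ k ⟩
          rowMap (λ j → x * Y r j + Z r j) k          ≈⟨ rowMap-linear x (Y r) (Z r) k ⟩
          x * rowMap (Y r) k + rowMap (Z r) k         ≈⟨ +-cong (*-congˡ (row Y r k)) (row Z r k) ⟨
          x * Φ Y (position r) k + Φ Z (position r) k ∎
      }
    ; alternating = λ X {r} {s} r≢s Xr≈Xs → F.alternating (Φ X) (r≢s ∘ position-injective)
        (λ k → trans (row X r k) (trans (rowMap-cong Xr≈Xs k) (sym (row X s k))))
    }
    where
    module F = IsAlternatingForm F-alt
    open IsRowLinear Φ-lin

  -- The determinant

  altF-cong : ∀ {n} (j : Fin n) {x y} → x ≈ y → altF j x ≈ altF j y
  altF-cong zero    x≈y = x≈y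
  altF-cong (suc j) x≈y = -‿cong (altF-cong j x≈y)

  altF-neg : ∀ {n} (j : Fin n) x → altF j (- x) ≈ - altF j x
  altF-neg zero    x = refl
  altF-neg (suc j) x = -‿cong (altF-neg j x)

  altF-+ : ∀ {n} (j : Fin n) x y → altF j (x + y) ≈ altF j x + altF j y
  altF-+ zero    x y = refl
  altF-+ (suc j) x y = trans (-‿cong (altF-+ j x y)) (sym (-‿+-comm _ _))

  altF-* : ∀ {n} (j : Fin n) x y → altF j (x * y) ≈ x * altF j y
  altF-* zero    x y = refl
  altF-* (suc j) x y = trans (-‿cong (altF-* j x y)) (-‿distribʳ-* x (altF j y))

  altF-0 : ∀ {n} (j : Fin n) {x} → x ≈ 0# → altF j x ≈ 0#
  altF-0 zero    x≈0 = x≈0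
  altF-0 (suc j) x≈0 = trans (-‿cong (altF-0 j x≈0)) -0#≈0#

  altF-≈± : ∀ {n} (j : Fin n) x → altF j x ≈± x
  altF-≈± zero    x = inj₁ refl
  altF-≈± (suc j) x = -‿≈± (altF-≈± j x)

  altF-linear : ∀ {n} (j : Fin n) x p q → altF j (x * p + q) ≈ x * altF j p + altF j q
  altF-linear j x p q = trans (altF-+ j (x * p) q) (+-congʳ (altF-* j x p))

  altF-punchOut-anticomm : ∀ {n} (j l : Fin (suc (suc n))) (j≢l : j ≢ l) (l≢j : l ≢ j) x →
                           altF j (altF (punchOut j≢l) x) ≈ - altF l (altF (punchOut l≢j) x)
  altF-punchOut-anticomm zero          zero          j≢l _   x = contradiction ≡.refl j≢l
  altF-punchOut-anticomm zero          (suc l)       _   _   x = sym (-‿involutive _)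
  altF-punchOut-anticomm (suc j)       zero          _   _   x = refl
  altF-punchOut-anticomm {zero} (suc zero) (suc zero) j≢l _   x = contradiction ≡.refl j≢l
  altF-punchOut-anticomm {suc n} (suc j) (suc l)     j≢l l≢j x = begin
    - altF j (- altF (punchOut j≢l′) x)   ≈⟨ -‿cong (altF-neg j _) ⟩
    - - altF j (altF (punchOut j≢l′) x)   ≈⟨ -‿involutive _ ⟩
    altF j (altF (punchOut j≢l′) x)       ≈⟨ altF-punchOut-anticomm j l j≢l′ l≢j′ x ⟩
    - altF l (altF (punchOut l≢j′) x)     ≈⟨ -‿cong (-‿involutive _) ⟨
    - - - altF l (altF (punchOut l≢j′) x) ≈⟨ -‿cong (-‿cong (altF-neg l _)) ⟨
    - - altF l (- altF (punchOut l≢j′) x) ∎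
    where
    j≢l′ : j ≢ l
    j≢l′ = j≢l ∘ ≡.cong suc
    l≢j′ : l ≢ j
    l≢j′ = l≢j ∘ ≡.cong suc

  det-cong : ∀ {n} {M M′ : Matrix n n} → M ≈ᴹ M′ → det M ≈ det M′
  det-cong {zero}  _    = refl
  det-cong {suc n} M≈M′ =
    ∑-cong (λ j → altF-cong j (*-cong (M≈M′ zero j) (det-cong (λ a b → M≈M′ (suc a) (punchIn j b)))))

  det-basisRow : ∀ {n} (M : Matrix (suc n) (suc n)) j → (∀ k → M zero k ≈ 𝟏 j k) →
                 det M ≈ altF j (det (minor M j))
  det-basisRow M j M₀≈ = begin
    det M                               ≈⟨ ∑-single j (λ k k≢j → altF-0 k (trans (*-congʳ (trans (M₀≈ k) (𝟏-≢ (k≢j ∘ ≡.sym))))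
                                                                                  (zeroˡ (det (minor M k))))) ⟩
    altF j (M zero j * det (minor M j)) ≈⟨ altF-cong j (trans (*-congʳ (trans (M₀≈ j) (𝟏-diag j))) (*-identityˡ _)) ⟩
    altF j (det (minor M j))            ∎

  det-𝟏 : ∀ {n} → det (𝟏 {n}) ≈ 1#
  det-𝟏 {zero}  = refl
  det-𝟏 {suc n} = trans (det-basisRow (𝟏 {suc n}) zero (λ _ → refl)) (det-𝟏 {n})

  det-linear : ∀ {n} r x {X Y Z : Matrix n n} → AgreeOff r X Y → AgreeOff r X Z →
               (∀ j → X r j ≈ x * Y r j + Z r j) → det X ≈ x * det Y + det Z
  det-linear {suc n} zero x {X} {Y} {Z} X~Y X~Z X₀≈ = ∑-linear x λ j → begin
    altF j (X zero j * det (minor X j))                ≈⟨ altF-cong j (*-cong (X₀≈ j) (det-cong (minor≈ X~Y j))) ⟩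
    altF j ((x * Y zero j + Z zero j) * det (minor Y j)) ≈⟨ altF-cong j (distribʳ _ _ _) ⟩
    altF j (x * Y zero j * det (minor Y j) + Z zero j * det (minor Y j))
      ≈⟨ altF-cong j (+-cong (*-assoc _ _ _) (*-congˡ (det-cong (λ a b → trans (sym (minor≈ X~Y j a b)) (minor≈ X~Z j a b))))) ⟩
    altF j (x * (Y zero j * det (minor Y j)) + Z zero j * det (minor Z j)) ≈⟨ altF-linear j x _ _ ⟩
    x * altF j (Y zero j * det (minor Y j)) + altF j (Z zero j * det (minor Z j)) ∎
    where
    minor≈ : ∀ {W} → AgreeOff zero X W → ∀ j → minor X j ≈ᴹ minor W j
    minor≈ X~W j a b = X~W (suc a) (λ ()) (punchIn j b)
  det-linear {suc n} (suc r) x {X} {Y} {Z} X~Y X~Z Xr≈ = ∑-linear x λ j → begin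
    altF j (X zero j * det (minor X j))
      ≈⟨ altF-cong j (*-congˡ (det-linear r x (minor~ X~Y j) (minor~ X~Z j) (λ b → Xr≈ (punchIn j b)))) ⟩
    altF j (X zero j * (x * det (minor Y j) + det (minor Z j)))
      ≈⟨ altF-cong j (distribˡ _ _ _) ⟩
    altF j (X zero j * (x * det (minor Y j)) + X zero j * det (minor Z j))
      ≈⟨ altF-cong j (+-cong (trans (x∙yz≈y∙xz _ _ _) (*-congˡ (*-congʳ (X~Y zero (λ ()) j)))) (*-congʳ (X~Z zero (λ ()) j))) ⟩
    altF j (x * (Y zero j * det (minor Y j)) + Z zero j * det (minor Z j)) ≈⟨ altF-linear j x _ _ ⟩
    x * altF j (Y zero j * det (minor Y j)) + altF j (Z zero j * det (minor Z j)) ∎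
    where
    minor~ : ∀ {W} → AgreeOff (suc r) X W → ∀ j → AgreeOff r (minor X j) (minor W j)
    minor~ X~W j i i≢r b = X~W (suc i) (i≢r ∘ suc-injective) (punchIn j b)

  det-isMultilinear : ∀ {n} → IsMultilinear (det {n})
  det-isMultilinear = record { cong = det-cong ; linear = det-linear }

  rowSwap-minor : ∀ {n r s} {X Y : Matrix (suc n) (suc n)} → RowSwap (suc r) (suc s) X Y →
                  ∀ j → RowSwap r s (minor X j) (minor Y j)
  rowSwap-minor swap j = record
    { at-r   = λ b → at-r (punchIn j b)
    ; at-s   = λ b → at-s (punchIn j b)
    ; others = λ i i≢r i≢s b → others (suc i) (i≢r ∘ suc-injective) (i≢s ∘ suc-injective) (punchIn j b)
    }
    where open RowSwap swap

  det-rowSwap-suc : ∀ {n} → IsAlternatingForm (det {n}) →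
                    ∀ {r s} {X Y : Matrix (suc n) (suc n)} → r ≢ s → RowSwap (suc r) (suc s) X Y → det Y ≈ - det X
  det-rowSwap-suc det-alt {X = X} {Y} r≢s swap = begin
    ∑ (λ j → altF j (Y zero j * det (minor Y j)))
      ≈⟨ ∑-cong (λ j → altF-cong j (*-cong (others zero (λ ()) (λ ()) j)
                                           (rowSwap-negates det-alt r≢s (rowSwap-minor swap j)))) ⟩
    ∑ (λ j → altF j (X zero j * - det (minor X j)))
      ≈⟨ ∑-cong (λ j → trans (altF-cong j (sym (-‿distribʳ-* (X zero j) (det (minor X j)))))
                             (altF-neg j (X zero j * det (minor X j)))) ⟩
    ∑ (λ j → - altF j (X zero j * det (minor X j)))
      ≈⟨ -‿∑ (λ j → altF j (X zero j * det (minor X j))) ⟨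
    - det X ∎
    where open RowSwap swap

  -- Expanding rows 0 and 1 along the standard basis gives ∑ⱼ ∑ₗ uⱼ uₗ b j l, where b j l,
  -- the determinant with rows eⱼ and eₗ on top, is antisymmetric in j and l.
  det-equalRows₀₁ : ∀ {n} (X : Matrix (suc (suc n)) (suc (suc n))) → (∀ k → X zero k ≈ X (suc zero) k) → det X ≈ 0#
  det-equalRows₀₁ {n} X X₀≈X₁ = begin
    det X
      ≈⟨ linear-∑ det-isMultilinear zero X u B (λ _ → agreeOff-zero (λ _ _ → refl)) (λ k → sym (∑-δʳ k u)) ⟩
    ∑ (λ j → u j * det (B j))
      ≈⟨ ∑-cong (λ j → *-congˡ {u j} (linear-∑ det-isMultilinear (suc zero) (B j) u (B₂ j) (λ l → B~B₂ {j} {l})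
                                  (λ k → trans (sym (X₀≈X₁ k)) (sym (∑-δʳ k u))))) ⟩
    ∑ (λ j → u j * ∑ (λ l → u l * b j l))
      ≈⟨ ∑-cong (λ j → *-distribˡ-∑ (u j) (λ l → u l * b j l)) ⟩
    ∑ (λ j → ∑ (λ l → u j * (u l * b j l)))
      ≈⟨ ∑∑-antisymmetric (λ j l → u j * (u l * b j l))
           (λ j → trans (*-congˡ (trans (*-congˡ (b-diag j)) (zeroʳ _))) (zeroʳ _))
           (λ j l → terms-anti (u j) (u l) (b-anti j l)) ⟩
    0# ∎
    where
    u : Fin (suc (suc n)) → Carrier
    u = X zero
    B : Fin (suc (suc n)) → Matrix (suc (suc n)) (suc (suc n))
    B j = 𝟏 j ∷ tail X
    B₂ : Fin (suc (suc n)) → Fin (suc (suc n)) → Matrix (suc (suc n)) (suc (suc n))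
    B₂ j l = 𝟏 j ∷ 𝟏 l ∷ tail (tail X)
    B~B₂ : ∀ {j l} → AgreeOff (suc zero) (B j) (B₂ j l)
    B~B₂ zero          _   _ = refl
    B~B₂ (suc zero)    1≢1 _ = contradiction ≡.refl 1≢1
    B~B₂ (suc (suc a)) _   _ = refl
    b : Fin (suc (suc n)) → Fin (suc (suc n)) → Carrier
    b j l = det (B₂ j l)
    b≈ : ∀ j l → b j l ≈ altF j (det (minor (B₂ j l) j))
    b≈ j l = det-basisRow (B₂ j l) j (λ _ → refl)
    b-diag : ∀ j → b j j ≈ 0#
    b-diag j = trans (b≈ j j) (altF-0 j (IsMultilinear.zero-row det-isMultilinear zero {minor (B₂ j j) j}
                                          (λ k → 𝟏-≢ (punchInᵢ≢i j k ∘ ≡.sym))))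
    R : ∀ {j l} → j ≢ l → Matrix n n
    R {j} j≢l a c = X (suc (suc a)) (punchIn j (punchIn (punchOut j≢l) c))
    b-off : ∀ j l (j≢l : j ≢ l) → b j l ≈ altF j (altF (punchOut j≢l) (det (R j≢l)))
    b-off j l j≢l = trans (b≈ j l) (altF-cong j (det-basisRow (minor (B₂ j l) j) (punchOut j≢l)
                      (λ k → trans (𝟏-sym l (punchIn j k)) (trans (𝟏-punchIn j≢l k) (𝟏-sym k (punchOut j≢l))))))
    b-anti : ∀ j l → b j l ≈ - b l j
    b-anti j l with j ≟ l
    ... | yes ≡.refl = trans (b-diag j) (sym (trans (-‿cong (b-diag j)) -0#≈0#))
    ... | no  j≢l    = begin
      b j l                                        ≈⟨ b-off j l j≢l ⟩
      altF j (altF (punchOut j≢l) (det (R j≢l)))   ≈⟨ altF-punchOut-anticomm j l j≢l l≢j _ ⟩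
      - altF l (altF (punchOut l≢j) (det (R j≢l))) ≈⟨ -‿cong (altF-cong l (altF-cong (punchOut l≢j) (det-cong R-sym))) ⟩
      - altF l (altF (punchOut l≢j) (det (R l≢j))) ≈⟨ -‿cong (b-off l j l≢j) ⟨
      - b l j                                      ∎
      where
      l≢j : l ≢ j
      l≢j = j≢l ∘ ≡.sym
      R-sym : R j≢l ≈ᴹ R l≢j
      R-sym a c = reflexive (≡.cong (X (suc (suc a))) (punchIn-punchOut-comm j l j≢l l≢j c))
    terms-anti : ∀ x y {p q} → p ≈ - q → x * (y * p) ≈ - (y * (x * q))
    terms-anti x y {p} {q} p≈-q = begin
      x * (y * p)     ≈⟨ x∙yz≈y∙xz x y p ⟩
      y * (x * p)     ≈⟨ *-congˡ (*-congˡ p≈-q) ⟩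
      y * (x * - q)   ≈⟨ *-congˡ (-‿distribʳ-* x q) ⟨
      y * - (x * q)   ≈⟨ -‿distribʳ-* y (x * q) ⟨
      - (y * (x * q)) ∎

  -- For s > 0, swapping rows 1 and s + 1 negates det (alternation of the minors) and makes rows 0 and 1 equal.
  det-equalRows₀ : ∀ {n} → IsAlternatingForm (det {n}) →
                   ∀ (X : Matrix (suc n) (suc n)) s → (∀ k → X zero k ≈ X (suc s) k) → det X ≈ 0#
  det-equalRows₀ {suc n} _       X zero    X₀≈ = det-equalRows₀₁ X X₀≈
  det-equalRows₀ {suc n} det-alt X (suc t) X₀≈ = begin
    det X     ≈⟨ -‿involutive _ ⟨
    - - det X ≈⟨ -‿cong (det-rowSwap-suc det-alt (λ ()) swap) ⟨
    - det Y   ≈⟨ -‿cong (det-equalRows₀₁ Y Y₀≈Y₁) ⟩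
    - 0#      ≈⟨ -0#≈0# ⟩
    0#        ∎
    where
    Y : Matrix (suc (suc n)) (suc (suc n))
    Y = X [ suc zero ]≔ X (suc (suc t)) [ suc (suc t) ]≔ X (suc zero)
    swap : RowSwap (suc zero) (suc (suc t)) X Y
    swap = swapRows-RowSwap X {suc zero} {suc (suc t)} (λ ())
    Y₀≈Y₁ : ∀ k → Y zero k ≈ Y (suc zero) k
    Y₀≈Y₁ k = trans (RowSwap.others swap zero (λ ()) (λ ()) k) (trans (X₀≈ k) (sym (RowSwap.at-r swap k)))

  det-alternating : ∀ {n} (X : Matrix n n) {r s} → r ≢ s → (∀ j → X r j ≈ X s j) → det X ≈ 0#
  det-isAlternatingForm : ∀ {n} → IsAlternatingForm (det {n})

  det-alternating {suc n} X {zero}  {zero}  r≢s _  = contradiction ≡.refl r≢s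
  det-alternating {suc n} X {zero}  {suc s} _   X≈ = det-equalRows₀ det-isAlternatingForm X s X≈
  det-alternating {suc n} X {suc r} {zero}  _   X≈ = det-equalRows₀ det-isAlternatingForm X r (sym ∘ X≈)
  det-alternating {suc n} X {suc r} {suc s} r≢s X≈ = ∑-zero (λ j → altF-0 j
    (trans (*-congˡ (det-alternating (minor X j) (r≢s ∘ ≡.cong suc) (X≈ ∘ punchIn j))) (zeroʳ (X zero j))))

  det-isAlternatingForm = record { isMultilinear = det-isMultilinear ; alternating = det-alternating }

  -- Uniqueness of alternating forms

  punchIn-cases : ∀ {n p} (j : Fin (suc n)) (P : Fin (suc n) → Set p) → P j → (∀ k → P (punchIn j k)) → ∀ i → P i
  punchIn-cases j P Pj Pk i with i ≟ j
  ... | yes ≡.refl = Pj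
  ... | no  i≢j    = ≡.subst P (punchIn-punchOut (i≢j ∘ ≡.sym)) (Pk (punchOut (i≢j ∘ ≡.sym)))

  insertAt-cong : ∀ {n} (j : Fin (suc n)) {u v : Fin n → Carrier} → (∀ k → u k ≈ v k) →
                  ∀ i → insertAt u j 0# i ≈ insertAt v j 0# i
  insertAt-cong j {u} {v} u≈v = punchIn-cases j (λ i → insertAt u j 0# i ≈ insertAt v j 0# i)
    (reflexive (≡.trans (insertAt-lookup u j 0#) (≡.sym (insertAt-lookup v j 0#))))
    (λ k → trans (reflexive (insertAt-punchIn u j 0# k)) (trans (u≈v k) (reflexive (≡.sym (insertAt-punchIn v j 0# k)))))

  insertAt-linear : ∀ {n} (j : Fin (suc n)) x (u v : Fin n → Carrier) →
                    ∀ i → insertAt (λ k → x * u k + v k) j 0# i ≈ x * insertAt u j 0# i + insertAt v j 0# i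
  insertAt-linear j x u v = punchIn-cases j (λ i → insertAt (λ k → x * u k + v k) j 0# i ≈ x * insertAt u j 0# i + insertAt v j 0# i)
    (begin
      insertAt (λ k → x * u k + v k) j 0# j ≡⟨ insertAt-lookup _ j 0# ⟩
      0#                                   ≈⟨ +-identityʳ 0# ⟨
      0# + 0#                              ≈⟨ +-congʳ (zeroʳ x) ⟨
      x * 0# + 0#                          ≡⟨ ≡.cong₂ (λ p q → x * p + q) (insertAt-lookup u j 0#) (insertAt-lookup v j 0#) ⟨
      x * insertAt u j 0# j + insertAt v j 0# j ∎)
    (λ k → reflexive (≡.trans (insertAt-punchIn _ j 0# k)
                        (≡.sym (≡.cong₂ (λ p q → x * p + q) (insertAt-punchIn u j 0# k) (insertAt-punchIn v j 0# k)))))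

  insertAt-removeAt-δ : ∀ {n} (j : Fin (suc n)) (v : Fin (suc n) → Carrier) →
                        ∀ i → v i ≈ insertAt (removeAt v j) j 0# i + v j * 𝟏 j i
  insertAt-removeAt-δ j v = punchIn-cases j (λ i → v i ≈ insertAt (removeAt v j) j 0# i + v j * 𝟏 j i)
    (begin
      v j                                        ≈⟨ *-identityʳ (v j) ⟨
      v j * 1#                                   ≈⟨ *-congˡ (𝟏-diag j) ⟨
      v j * 𝟏 j j                                ≈⟨ +-identityˡ _ ⟨
      0# + v j * 𝟏 j j                           ≡⟨ ≡.cong (_+ v j * 𝟏 j j) (insertAt-lookup (removeAt v j) j 0#) ⟨
      insertAt (removeAt v j) j 0# j + v j * 𝟏 j j ∎)
    (λ k → begin
      v (punchIn j k)                            ≈⟨ +-identityʳ _ ⟨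
      v (punchIn j k) + 0#                       ≈⟨ +-congˡ (trans (*-congˡ (𝟏-≢ (punchInᵢ≢i j k ∘ ≡.sym))) (zeroʳ (v j))) ⟨
      v (punchIn j k) + v j * 𝟏 j (punchIn j k)  ≡⟨ ≡.cong (_+ v j * 𝟏 j (punchIn j k)) (insertAt-punchIn (removeAt v j) j 0# k) ⟨
      insertAt (removeAt v j) j 0# (punchIn j k) + v j * 𝟏 j (punchIn j k) ∎)

  extend : ∀ {n} → Fin (suc n) → Matrix n n → Matrix (suc n) (suc n)
  extend j K = 𝟏 j ∷ (λ a → insertAt (K a) j 0#)

  extend-isRowLinear : ∀ {n} (j : Fin (suc n)) → IsRowLinear (extend j)
  extend-isRowLinear j = record
    { position           = suc
    ; position-injective = suc-injective
    ; rowMap             = λ v → insertAt v j 0#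
    ; rowMap-cong        = insertAt-cong j
    ; rowMap-linear      = insertAt-linear j
    ; row                = λ _ _ _ → refl
    ; agreeOff           = λ { X~Y zero _ k → refl ; X~Y (suc i) i≢r k → insertAt-cong j (X~Y i (i≢r ∘ ≡.cong suc)) k }
    ; cong               = λ { X≈Y zero k → refl ; X≈Y (suc a) k → insertAt-cong j (X≈Y a) k }
    }

  -- Swapping the first two rows of extend (suc j) 𝟏 gives extend zero (extend j 𝟏).
  extend-𝟏 : ∀ {n} {F : Matrix (suc n) (suc n) → Carrier} → IsAlternatingForm F → ∀ j → F (extend j 𝟏) ≈ altF j (F 𝟏)
  extend-𝟏 F-alt zero = IsAlternatingForm.cong F-alt (λ { zero k → refl ; (suc a) zero → refl ; (suc a) (suc k) → refl })
  extend-𝟏 {suc n} {F} F-alt (suc j) = begin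
    F (extend (suc j) 𝟏)            ≈⟨ -‿involutive _ ⟨
    - - F (extend (suc j) 𝟏)        ≈⟨ -‿cong (rowSwap-negates F-alt (λ ()) swap) ⟨
    - F (extend zero (extend j 𝟏))  ≈⟨ -‿cong (extend-𝟏 (∘-isAlternatingForm F-alt (extend-isRowLinear zero)) j) ⟩
    - altF j (F (extend zero 𝟏))    ≈⟨ -‿cong (altF-cong j (extend-𝟏 F-alt zero)) ⟩
    - altF j (F 𝟏)                  ∎
    where
    swap : RowSwap zero (suc zero) (extend (suc j) 𝟏) (extend zero (extend j 𝟏))
    swap = record
      { at-r   = λ { zero → refl ; (suc k) → sym (trans (insertAt-cong j (λ _ → refl) k) (insertAt-zero j k)) }
      ; at-s   = λ { zero → refl ; (suc k) → refl }
      ; others = λ { zero 0≢0 _ _ → contradiction ≡.refl 0≢0 ; (suc zero) _ 1≢1 _ → contradiction ≡.refl 1≢1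
                   ; (suc (suc a)) _ _ zero → refl ; (suc (suc a)) _ _ (suc k) → refl }
      }
      where
      insertAt-zero : ∀ {m} (j : Fin (suc m)) k → insertAt (λ _ → 0#) j 0# k ≈ 0#
      insertAt-zero j = punchIn-cases j (λ k → insertAt (λ _ → 0#) j 0# k ≈ 0#)
        (reflexive (insertAt-lookup _ j 0#)) (λ k → reflexive (insertAt-punchIn _ j 0# k))

  -- Expand row 0 along the standard basis.  In the j-th term the row eⱼ clears column j of the
  -- other rows, leaving F ∘ extend j, an alternating form in one dimension less.
  alternatingForm-unique : ∀ {n} {F : Matrix n n → Carrier} → IsAlternatingForm F → ∀ M → F M ≈ det M * F 𝟏
  alternatingForm-unique {zero}  F-alt M = trans (IsAlternatingForm.cong F-alt (λ ())) (sym (*-identityˡ _))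
  alternatingForm-unique {suc n} {F} F-alt M = begin
    F M                                               ≈⟨ linear-∑ isMultilinear zero M (M zero) Ys
                                                           (λ _ → agreeOff-zero (λ _ _ → refl)) (λ k → sym (∑-δʳ k (M zero))) ⟩
    ∑ (λ j → M zero j * F (Ys j))                     ≈⟨ ∑-cong (λ j → *-congˡ {M zero j} (Ys-value j)) ⟩
    ∑ (λ j → M zero j * (det (minor M j) * altF j (F 𝟏))) ≈⟨ ∑-cong (λ j → reassociate (M zero j) (det (minor M j)) j) ⟩
    ∑ (λ j → altF j (M zero j * det (minor M j)) * F 𝟏) ≈⟨ *-distribʳ-∑ (F 𝟏) (λ j → altF j (M zero j * det (minor M j))) ⟨
    det M * F 𝟏                                        ∎
    where
    open IsAlternatingForm F-alt
    Ys : Fin (suc n) → Matrix (suc n) (suc n)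
    Ys j = 𝟏 j ∷ tail M
    Ys-value : ∀ j → F (Ys j) ≈ det (minor M j) * altF j (F 𝟏)
    Ys-value j = begin
      F (Ys j)
        ≈⟨ cong (λ { zero k → refl ; (suc a) k → insertAt-removeAt-δ j (M (suc a)) k }) ⟩
      F (𝟏 j ∷ (λ a k → insertAt (minor M j a) j 0# k + M (suc a) j * 𝟏 j k))
        ≈⟨ addMultiples-invariant (𝟏 j) (∷-isMultilinear (𝟏 j) isMultilinear)
             (λ Y a Ya≈ → alternating (𝟏 j ∷ Y) {suc a} {zero} (λ ()) Ya≈) (λ a → insertAt (minor M j a) j 0#) (λ a → M (suc a) j) ⟩
      F (extend j (minor M j))
        ≈⟨ alternatingForm-unique (∘-isAlternatingForm F-alt (extend-isRowLinear j)) (minor M j) ⟩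
      det (minor M j) * F (extend j 𝟏)
        ≈⟨ *-congˡ (extend-𝟏 F-alt j) ⟩
      det (minor M j) * altF j (F 𝟏) ∎
    reassociate : ∀ m d j → m * (d * altF j (F 𝟏)) ≈ altF j (m * d) * F 𝟏
    reassociate m d j = begin
      m * (d * altF j (F 𝟏)) ≈⟨ *-assoc m d _ ⟨
      m * d * altF j (F 𝟏)   ≈⟨ altF-* j (m * d) (F 𝟏) ⟨
      altF j (m * d * F 𝟏)   ≈⟨ altF-cong j (*-comm (m * d) (F 𝟏)) ⟩
      altF j (F 𝟏 * (m * d)) ≈⟨ altF-* j (F 𝟏) (m * d) ⟩
      F 𝟏 * altF j (m * d)   ≈⟨ *-comm (F 𝟏) _ ⟩
      altF j (m * d) * F 𝟏   ∎

  det-⊗ : ∀ {n} (A B : Matrix n n) → det (A ⊗ B) ≈ det A * det B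
  det-⊗ A B = trans (alternatingForm-unique (∘-isAlternatingForm det-isAlternatingForm ⊗B-isRowLinear) A)
                    (*-congˡ (det-cong (⊗-identityˡ B)))
    where
    ⊗B-isRowLinear : IsRowLinear (_⊗ B)
    ⊗B-isRowLinear = record
      { position           = λ r → r
      ; position-injective = λ r≡s → r≡s
      ; rowMap             = λ v k → ∑ (λ l → v l * B l k)
      ; rowMap-cong        = λ u≈v k → ∑-cong (λ l → *-congʳ (u≈v l))
      ; rowMap-linear      = λ x u v k → ∑-linear x {g = λ l → u l * B l k} {λ l → v l * B l k}
                                 (λ l → trans (distribʳ (B l k) (x * u l) (v l)) (+-congʳ (*-assoc x (u l) (B l k))))
      ; row                = λ _ _ _ → refl
      ; agreeOff           = λ X~Y i i≢r k → ∑-cong (λ l → *-congʳ (X~Y i i≢r l))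
      ; cong               = λ X≈Y → ⊗-cong X≈Y (λ _ _ → refl)
      }

  -- Determinants of block matrices

  block-suc-suc : ∀ {a b d e} (A : Matrix (suc a) (suc d)) (B : Matrix (suc a) e) (C : Matrix b (suc d)) (D : Matrix b e) x y →
                  block A B C D (suc x) (suc y) ≡ block (λ i j → A (suc i) (suc j)) (λ i j → B (suc i) j) (λ i j → C i (suc j)) D x y
  block-suc-suc {a} {d = d} A B C D x y with splitAt a x | splitAt d y
  ... | inj₁ i | inj₁ j = ≡.refl
  ... | inj₁ i | inj₂ j = ≡.refl
  ... | inj₂ i | inj₁ j = ≡.refl
  ... | inj₂ i | inj₂ j = ≡.refl

  det-block-lower-𝟏 : ∀ {a b} (C : Matrix b a) (S : Matrix b b) → det (block 𝟏 𝟎 C S) ≈ det S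
  det-block-lower-𝟏 {zero}      C S = det-cong {M = block 𝟏 𝟎 C S} (λ _ _ → refl)
  det-block-lower-𝟏 {suc a} {b} C S = begin
    det (block 𝟏 𝟎 C S)                     ≈⟨ det-basisRow (block 𝟏 𝟎 C S) zero row₀ ⟩
    det (minor (block 𝟏 𝟎 C S) zero)        ≈⟨ det-cong (λ x y → reflexive (block-suc-suc 𝟏 𝟎 C S x y)) ⟩
    det (block 𝟏 𝟎 (λ i j → C i (suc j)) S) ≈⟨ det-block-lower-𝟏 (λ i j → C i (suc j)) S ⟩
    det S                                   ∎
    where
    row₀ : ∀ k → block 𝟏 𝟎 C S zero k ≈ 𝟏 zero k
    row₀ zero    = refl
    row₀ (suc k) with splitAt a k
    ... | inj₁ _ = refl
    ... | inj₂ _ = refl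

  det-zeroColumn : ∀ {n} (M : Matrix n n) z → (∀ i → M i z ≈ 0#) → det M ≈ 0#
  det-zeroColumn {suc n} M z M·z≈0 = ∑-zero (λ j → altF-0 j (term j (j ≟ z)))
    where
    term : ∀ j → Dec (j ≡ z) → M zero j * det (minor M j) ≈ 0#
    term j (yes ≡.refl) = trans (*-congʳ (M·z≈0 zero)) (zeroˡ _)
    term j (no  j≢z)    = trans (*-congˡ (det-zeroColumn (minor M j) (punchOut j≢z)
      (λ a → trans (reflexive (≡.cong (M (suc a)) (punchIn-punchOut j≢z))) (M·z≈0 (suc a))))) (zeroʳ _)

  det-block-upper-𝟏 : ∀ {a b} (Q : Matrix a b) (S : Matrix b b) → det (block 𝟏 Q 𝟎 S) ≈ det S
  det-block-upper-𝟏 {zero}  Q S = det-cong {M = block 𝟏 Q 𝟎 S} (λ _ _ → refl)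
  det-block-upper-𝟏 {suc a} {b} Q S = begin
    det M                                   ≈⟨ +-cong (*-identityˡ _) (∑-zero (λ k → altF-0 (suc k)
                                                 (trans (*-congˡ (minor-singular k)) (zeroʳ _)))) ⟩
    det (minor M zero) + 0#                 ≈⟨ +-identityʳ _ ⟩
    det (minor M zero)                      ≈⟨ det-cong (λ x y → reflexive (block-suc-suc 𝟏 Q 𝟎 S x y)) ⟩
    det (block 𝟏 (λ i j → Q (suc i) j) 𝟎 S) ≈⟨ det-block-upper-𝟏 (λ i j → Q (suc i) j) S ⟩
    det S                                   ∎
    where
    M : Matrix (suc a +ℕ b) (suc a +ℕ b)
    M = block 𝟏 Q 𝟎 S
    column₀ : ∀ x → M (suc x) zero ≈ 0#
    column₀ x with splitAt a x
    ... | inj₁ _ = refl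
    ... | inj₂ _ = refl
    minor-singular : ∀ k → det (minor M (suc k)) ≈ 0#
    minor-singular k = det-zeroColumn (minor M (suc k)) (punchOut k+1≢0)
      (λ x → trans (reflexive (≡.cong (M (suc x)) (punchIn-punchOut k+1≢0))) (column₀ x))
      where
      k+1≢0 : suc k ≢ zero
      k+1≢0 ()

  det-block-lower : ∀ {a b} (P : Matrix a a) (C : Matrix b a) (S : Matrix b b) → det (block P 𝟎 C S) ≈ det P * det S
  det-block-lower {a} {b} P C S =
    trans (alternatingForm-unique (∘-isAlternatingForm det-isAlternatingForm upperLeft-isRowLinear) P)
          (*-congˡ (det-block-lower-𝟏 C S))
    where
    padRow : (Fin a → Carrier) → Fin (a +ℕ b) → Carrier
    padRow v k = hcat (λ _ → v) (𝟎 {1} {b}) zero k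
    padRow-cong : ∀ {u v} → (∀ j → u j ≈ v j) → ∀ k → padRow u k ≈ padRow v k
    padRow-cong {u} {v} u≈v = hcat-cong {A = λ _ → u} {λ _ → v} {𝟎 {1} {b}} {𝟎} (λ _ → u≈v) (λ _ _ → refl) zero
    padRow-linear : ∀ x u v k → padRow (λ j → x * u j + v j) k ≈ x * padRow u k + padRow v k
    padRow-linear x u v k with splitAt a k
    ... | inj₁ _ = refl
    ... | inj₂ _ = sym (trans (+-congʳ (zeroʳ x)) (+-identityˡ 0#))
    upperLeft-isRowLinear : IsRowLinear (λ X → block X 𝟎 C S)
    upperLeft-isRowLinear = record
      { position           = _↑ˡ b
      ; position-injective = ↑ˡ-injective b _ _
      ; rowMap             = padRow
      ; rowMap-cong        = padRow-cong
      ; rowMap-linear      = padRow-linear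
      ; row                = λ X r k → reflexive (vcat-↑ˡ (hcat X 𝟎) (hcat C S) r k)
      ; agreeOff           = λ {r} {X} {Y} X~Y → ↑-elim a b (λ i → i ≢ r ↑ˡ b → ∀ k → block X 𝟎 C S i k ≈ block Y 𝟎 C S i k)
          (λ i i≢r k → trans (reflexive (vcat-↑ˡ (hcat X 𝟎) (hcat C S) i k))
                         (trans (padRow-cong (X~Y i (i≢r ∘ ≡.cong (_↑ˡ b))) k)
                                (reflexive (≡.sym (vcat-↑ˡ (hcat Y 𝟎) (hcat C S) i k)))))
          (λ i _ k → reflexive (≡.trans (vcat-↑ʳ (hcat X 𝟎) (hcat C S) i k)
                                        (≡.sym (vcat-↑ʳ (hcat Y 𝟎) (hcat C S) i k))))
      ; cong               = λ X≈Y → vcat-cong (hcat-cong X≈Y (λ _ _ → refl)) (λ _ _ → refl)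
      }

  det-block-upper : ∀ {a b} (P : Matrix a a) (Q : Matrix a b) (S : Matrix b b) → det (block P Q 𝟎 S) ≈ det P * det S
  det-block-upper {a} {b} P Q S = begin
    det (block P Q 𝟎 S)                         ≈⟨ det-cong factor ⟩
    det (block 𝟏 Q 𝟎 S ⊗ block P 𝟎 𝟎 𝟏)         ≈⟨ det-⊗ (block 𝟏 Q 𝟎 S) (block P 𝟎 𝟎 𝟏) ⟩
    det (block 𝟏 Q 𝟎 S) * det (block P 𝟎 𝟎 𝟏)   ≈⟨ *-cong (det-block-upper-𝟏 Q S) (det-block-lower P 𝟎 𝟏) ⟩
    det S * (det P * det (𝟏 {b}))               ≈⟨ *-congˡ (trans (*-congˡ (det-𝟏 {b})) (*-identityʳ _)) ⟩
    det S * det P                               ≈⟨ *-comm _ _ ⟩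
    det P * det S                               ∎
    where
    factor : block P Q 𝟎 S ≈ᴹ (block 𝟏 Q 𝟎 S ⊗ block P 𝟎 𝟎 𝟏)
    factor = ≈ᴹ.sym (≈ᴹ.trans (block-⊗-block 𝟏 Q 𝟎 S P 𝟎 𝟎 𝟏) (block-cong
      (≈ᴹ.trans (⊕-identityʳ (⊗-zeroʳ Q)) (⊗-identityˡ P))
      (≈ᴹ.trans (⊕-identityˡ (⊗-zeroʳ 𝟏)) (⊗-identityʳ Q))
      (≈ᴹ.trans (⊕-identityˡ (⊗-zeroˡ P)) (⊗-zeroʳ S))
      (≈ᴹ.trans (⊕-identityˡ (⊗-zeroˡ {b} {a} {b} 𝟎)) (⊗-identityʳ S))))

  -- Y stands for A⁻¹B and S for the Schur complement D − CA⁻¹B, but A need not be invertible.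
  det-block-schurˡ : ∀ {a b} {A : Matrix a a} {B : Matrix a b} {C : Matrix b a} {D : Matrix b b} (Y : Matrix a b) (S : Matrix b b) →
                     B ≈ᴹ (A ⊗ Y) → ((C ⊗ Y) ⊕ S) ≈ᴹ D → det (block A B C D) ≈ det A * det S
  det-block-schurˡ {a} {b} {A} {B} {C} {D} Y S B≈AY CY+S≈D = begin
    det (block A B C D)                          ≈⟨ det-cong factor ⟩
    det (block A 𝟎 C 𝟏 ⊗ block 𝟏 Y 𝟎 S)          ≈⟨ det-⊗ (block A 𝟎 C 𝟏) (block 𝟏 Y 𝟎 S) ⟩
    det (block A 𝟎 C 𝟏) * det (block 𝟏 Y 𝟎 S)    ≈⟨ *-cong (det-block-lower A C 𝟏) (det-block-upper 𝟏 Y S) ⟩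
    (det A * det (𝟏 {b})) * (det (𝟏 {a}) * det S) ≈⟨ *-cong (trans (*-congˡ (det-𝟏 {b})) (*-identityʳ _))
                                                            (trans (*-congʳ (det-𝟏 {a})) (*-identityˡ _)) ⟩
    det A * det S                                ∎
    where
    factor : block A B C D ≈ᴹ (block A 𝟎 C 𝟏 ⊗ block 𝟏 Y 𝟎 S)
    factor = ≈ᴹ.sym (≈ᴹ.trans (block-⊗-block A 𝟎 C 𝟏 𝟏 Y 𝟎 S) (block-cong
      (≈ᴹ.trans (⊕-identityʳ (⊗-zeroˡ {a} {b} {a} 𝟎)) (⊗-identityʳ A))
      (≈ᴹ.trans (⊕-identityʳ (⊗-zeroˡ S)) (≈ᴹ.sym B≈AY))
      (≈ᴹ.trans (⊕-identityʳ (⊗-zeroʳ 𝟏)) (⊗-identityʳ C))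
      (≈ᴹ.trans (⊕-cong ≈ᴹ.refl (⊗-identityˡ S)) CY+S≈D)))

  -- Y stands for BD⁻¹ and S for the Schur complement A − BD⁻¹C.
  det-block-schurʳ : ∀ {a b} {A : Matrix a a} {B : Matrix a b} {C : Matrix b a} {D : Matrix b b} (Y : Matrix a b) (S : Matrix a a) →
                     B ≈ᴹ (Y ⊗ D) → (S ⊕ (Y ⊗ C)) ≈ᴹ A → det (block A B C D) ≈ det S * det D
  det-block-schurʳ {a} {b} {A} {B} {C} {D} Y S B≈YD S+YC≈A = begin
    det (block A B C D)                          ≈⟨ det-cong factor ⟩
    det (block 𝟏 Y 𝟎 𝟏 ⊗ block S 𝟎 C D)          ≈⟨ det-⊗ (block 𝟏 Y 𝟎 𝟏) (block S 𝟎 C D) ⟩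
    det (block 𝟏 Y 𝟎 𝟏) * det (block S 𝟎 C D)    ≈⟨ *-cong (det-block-upper 𝟏 Y 𝟏) (det-block-lower S C D) ⟩
    (det (𝟏 {a}) * det (𝟏 {b})) * (det S * det D) ≈⟨ trans (*-congʳ (trans (*-cong (det-𝟏 {a}) (det-𝟏 {b})) (*-identityˡ 1#)))
                                                            (*-identityˡ _) ⟩
    det S * det D                                ∎
    where
    factor : block A B C D ≈ᴹ (block 𝟏 Y 𝟎 𝟏 ⊗ block S 𝟎 C D)
    factor = ≈ᴹ.sym (≈ᴹ.trans (block-⊗-block 𝟏 Y 𝟎 𝟏 S 𝟎 C D) (block-cong
      (≈ᴹ.trans (⊕-cong (⊗-identityˡ S) ≈ᴹ.refl) S+YC≈A)
      (≈ᴹ.trans (⊕-identityˡ (⊗-zeroʳ 𝟏)) (≈ᴹ.sym B≈YD))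
      (≈ᴹ.trans (⊕-identityˡ (⊗-zeroˡ S)) (⊗-identityˡ C))
      (≈ᴹ.trans (⊕-identityˡ (⊗-zeroˡ {b} {a} {b} 𝟎)) (⊗-identityˡ D))))

  det-rowsOf : ∀ {n} (σ : Fin n → Fin n) → (∀ {i j} → σ i ≡ σ j → i ≡ j) → det (rowsOf σ) ≈± 1#
  det-rowsOf {zero}  σ σ-injective = inj₁ refl
  det-rowsOf {suc n} σ σ-injective =
    ≈±-trans (inj₁ expand) (≈±-trans (altF-≈± (σ zero) _) (det-rowsOf σ′ σ′-injective))
    where
    σ₀≢ : ∀ a → σ zero ≢ σ (suc a)
    σ₀≢ a σ₀≡ with σ-injective σ₀≡
    ... | ()
    σ′ : Fin n → Fin n
    σ′ a = punchOut (σ₀≢ a)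
    σ′-injective : ∀ {a a′} → σ′ a ≡ σ′ a′ → a ≡ a′
    σ′-injective eq = suc-injective (σ-injective (punchOut-injective (σ₀≢ _) (σ₀≢ _) eq))
    expand : det (rowsOf σ) ≈ altF (σ zero) (det (rowsOf σ′))
    expand = trans (det-basisRow (rowsOf σ) (σ zero) (λ k → 𝟏-sym k (σ zero)))
                   (altF-cong (σ zero) (det-cong (λ a b → 𝟏-punchIn (σ₀≢ a) b)))

  swapHalves : ∀ n m → Fin (n +ℕ m) → Fin (m +ℕ n)
  swapHalves n m i = join m n (⊎.swap (splitAt n i))

  swapHalves-injective : ∀ n m {i j} → swapHalves n m i ≡ swapHalves n m j → i ≡ j
  swapHalves-injective n m {i} {j} eq = ≡.trans (≡.sym (inverse i)) (≡.trans (≡.cong unswap eq) (inverse j))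
    where
    unswap : Fin (m +ℕ n) → Fin (n +ℕ m)
    unswap k = join n m (⊎.swap (splitAt m k))
    inverse : ∀ i → unswap (swapHalves n m i) ≡ i
    inverse i = ≡.trans (≡.cong (join n m ∘ ⊎.swap) (splitAt-join m n (⊎.swap (splitAt n i))))
                        (≡.trans (≡.cong (join n m) (swap-involutive (splitAt n i))) (join-splitAt n m i))

  det-blockSwap : ∀ n m → det (castCols (ℕ.+-comm n m) (block {n} {m} {m} {n} 𝟎 𝟏 𝟏 𝟎)) ≈± 1#
  det-blockSwap n m = ≈±-respˡ (det-cong blockSwap≈rowsOf) (det-rowsOf σ σ-injective)
    where
    σ : Fin (n +ℕ m) → Fin (n +ℕ m)
    σ = cast (ℕ.+-comm m n) ∘ swapHalves n m
    σ-injective : ∀ {i j} → σ i ≡ σ j → i ≡ j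
    σ-injective {i} {j} eq =
      swapHalves-injective n m (≡.trans (≡.sym (uncast i)) (≡.trans (≡.cong (cast (ℕ.+-comm n m)) eq) (uncast j)))
      where
      uncast : ∀ i → cast (ℕ.+-comm n m) (σ i) ≡ swapHalves n m i
      uncast i = cast-involutive (ℕ.+-comm n m) (ℕ.+-comm m n) (swapHalves n m i)
    halves : block {n} {m} {m} {n} 𝟎 𝟏 𝟏 𝟎 ≈ᴹ rowsOf (swapHalves n m)
    halves = ≈ᴹ.trans (vcat-cong {n} (≈ᴹ.trans (hcat-cong {A = 𝟎} {𝟎} ≈ᴹ.refl (λ i j → 𝟏-sym i j)) (≈ᴹ.sym (rowsOf-↑ʳ m (λ i → i))))
                                     (≈ᴹ.trans (hcat-cong {B = 𝟎} {𝟎} (λ i j → 𝟏-sym i j) ≈ᴹ.refl) (≈ᴹ.sym (rowsOf-↑ˡ n (λ i → i)))))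
                      vcat-rowsOf
      where
      vcat-rowsOf : vcat (rowsOf (m ↑ʳ_)) (rowsOf (_↑ˡ n)) ≈ᴹ rowsOf (swapHalves n m)
      vcat-rowsOf i j with splitAt n i
      ... | inj₁ _ = refl
      ... | inj₂ _ = refl
    blockSwap≈rowsOf : castCols (ℕ.+-comm n m) (block {n} {m} {m} {n} 𝟎 𝟏 𝟏 𝟎) ≈ᴹ rowsOf σ
    blockSwap≈rowsOf = ≈ᴹ.trans (castCols-cong (ℕ.+-comm n m) halves) (castCols-rowsOf (ℕ.+-comm n m) (swapHalves n m))

  det-neg𝟏 : ∀ {n} → det (neg (𝟏 {n})) ≈± 1#
  det-neg𝟏 {zero}  = inj₁ refl
  det-neg𝟏 {suc n} = ≈±-respˡ expand (-‿≈± (det-neg𝟏 {n}))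
    where
    expand : det (neg (𝟏 {suc n})) ≈ - det (neg (𝟏 {n}))
    expand = trans (∑-single zero {λ k → altF k (neg 𝟏 zero k * det (minor (neg (𝟏 {suc n})) k))} off-diagonal)
                   (-1*x≈-x (det (neg (𝟏 {n}))))
      where
      off-diagonal : ∀ k → k ≢ zero → altF k (neg 𝟏 zero k * det (minor (neg 𝟏) k)) ≈ 0#
      off-diagonal k k≢0 = altF-0 k (trans (*-congʳ (trans (-‿cong (𝟏-≢ (k≢0 ∘ ≡.sym))) -0#≈0#)) (zeroˡ _))

  -- The construction

  open Construction

  -- X plays the role of the J-columns of N⁻¹, whose I-rows are the value V.
  record Represents {n m} (C : Construction n m) (V : Matrix n m) : Set (c ⊔ ℓ) where
    field
      X        : Matrix (size C) m
      N⊗X≈J    : (N C ⊗ X) ≈ᴹ colsOf (J C)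
      I-rows≈V : (rowsOf (I C) ⊗ X) ≈ᴹ V

  input-represents : ∀ {n m} (A : Matrix n m) → Represents (construct (input A)) A
  input-represents {n} {m} A = record
    { X        = vcat A (neg 𝟏)
    ; N⊗X≈J    = ≈ᴹ.trans (block-⊗-vcat 𝟏 A 𝟎 (neg 𝟏) A (neg 𝟏))
                 (≈ᴹ.trans (vcat-cong top bottom) (≈ᴹ.sym (colsOf-↑ʳ n (λ j → j))))
    ; I-rows≈V = ≈ᴹ.trans (rowsOf-↑ˡ-⊗-vcat (λ i → i) A (neg 𝟏)) (rowsOf-⊗ (λ i → i) A)
    }
    where
    top : ((𝟏 ⊗ A) ⊕ (A ⊗ neg 𝟏)) ≈ᴹ 𝟎
    top = ≈ᴹ.trans (⊕-cong ≈ᴹ.refl (⊗-negʳ A 𝟏)) (⊕-cancelʳ (≈ᴹ.trans (⊗-identityˡ A) (≈ᴹ.sym (⊗-identityʳ A))))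
    bottom : ((𝟎 ⊗ A) ⊕ (neg 𝟏 ⊗ neg 𝟏)) ≈ᴹ 𝟏
    bottom = ≈ᴹ.trans (⊕-identityˡ (⊗-zeroˡ A))
             (≈ᴹ.trans (⊗-negˡ 𝟏 (neg 𝟏)) (≈ᴹ.trans (neg-cong (≈ᴹ.trans (⊗-negʳ 𝟏 𝟏) (neg-cong (⊗-identityˡ 𝟏))))
                                                     (λ i j → -‿involutive _)))

  input-det : ∀ {n m} (A : Matrix n m) → det (N (construct (input A))) ≈± 1#
  input-det {n} {m} A = ≈±-respˡ (trans (det-block-upper 𝟏 A (neg 𝟏)) (trans (*-congʳ (det-𝟏 {n})) (*-identityˡ _))) (det-neg𝟏 {m})

  mul-represents : ∀ {n k m} (f : Formula n k) (g : Formula k m) {VL VR} →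
                   Represents (construct f) VL → Represents (construct g) VR → Represents (construct (mul f g)) (VL ⊗ VR)
  mul-represents {n} {k} {m} f g {VL} {VR} repL repR = record
    { X        = vcat (XL ⊗ VR) XR
    ; N⊗X≈J    = ≈ᴹ.trans (block-⊗-vcat (N L) (neg E) 𝟎 (N R) (XL ⊗ VR) XR)
                 (≈ᴹ.trans (vcat-cong top (≈ᴹ.trans (⊕-identityˡ (⊗-zeroˡ (XL ⊗ VR))) NR⊗XR≈J))
                           (≈ᴹ.sym (colsOf-↑ʳ (size L) (J R))))
    ; I-rows≈V = ≈ᴹ.trans (rowsOf-↑ˡ-⊗-vcat (I L) (XL ⊗ VR) XR)
                 (≈ᴹ.trans (≈ᴹ.sym (⊗-assoc (rowsOf (I L)) XL VR)) (⊗-cong IL-rows≈VL ≈ᴹ.refl))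
    }
    where
    L : Construction n k
    L = construct f
    R : Construction k m
    R = construct g
    open Represents repL renaming (X to XL; N⊗X≈J to NL⊗XL≈J; I-rows≈V to IL-rows≈VL)
    open Represents repR renaming (X to XR; N⊗X≈J to NR⊗XR≈J; I-rows≈V to IR-rows≈VR)
    E : Matrix (size L) (size R)
    E = colsOf (J L) ⊗ rowsOf (I R)
    top : ((N L ⊗ (XL ⊗ VR)) ⊕ (neg E ⊗ XR)) ≈ᴹ 𝟎
    top = ≈ᴹ.trans (⊕-cong (≈ᴹ.trans (≈ᴹ.sym (⊗-assoc (N L) XL VR)) (⊗-cong NL⊗XL≈J ≈ᴹ.refl))
                           (≈ᴹ.trans (⊗-negˡ E XR) (neg-cong (⊗-assoc (colsOf (J L)) (rowsOf (I R)) XR))))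
                   (⊕-cancelʳ (⊗-cong ≈ᴹ.refl (≈ᴹ.sym IR-rows≈VR)))

  mul-det : ∀ {n k m} (f : Formula n k) (g : Formula k m) →
            det (N (construct (mul f g))) ≈ det (N (construct f)) * det (N (construct g))
  mul-det f g = det-block-upper (N (construct f)) _ (N (construct g))

  inv-represents : ∀ {n} (f : Formula n n) {B V} → Represents (construct f) B → (B ⊗ V) ≈ᴹ 𝟏 →
                   Represents (construct (inv f)) V
  inv-represents {n} f {B} {V} rep B⊗V≈𝟏 = record
    { X        = vcat (X′ ⊗ V) V
    ; N⊗X≈J    = ≈ᴹ.trans (block-⊗-vcat (N C) (neg (colsOf (J C))) (rowsOf (I C)) 𝟎 (X′ ⊗ V) V)
                 (≈ᴹ.trans (vcat-cong top bottom) (≈ᴹ.sym (colsOf-↑ʳ (size C) (λ j → j))))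
    ; I-rows≈V = ≈ᴹ.trans (rowsOf-↑ʳ-⊗-vcat (λ i → i) (X′ ⊗ V) V) (rowsOf-⊗ (λ i → i) V)
    }
    where
    C : Construction n n
    C = construct f
    open Represents rep renaming (X to X′)
    top : ((N C ⊗ (X′ ⊗ V)) ⊕ (neg (colsOf (J C)) ⊗ V)) ≈ᴹ 𝟎
    top = ≈ᴹ.trans (⊕-cong (≈ᴹ.trans (≈ᴹ.sym (⊗-assoc (N C) X′ V)) (⊗-cong N⊗X≈J ≈ᴹ.refl)) (⊗-negˡ (colsOf (J C)) V))
                   (⊕-cancelʳ ≈ᴹ.refl)
    bottom : ((rowsOf (I C) ⊗ (X′ ⊗ V)) ⊕ (𝟎 ⊗ V)) ≈ᴹ 𝟏
    bottom = ≈ᴹ.trans (⊕-identityʳ (⊗-zeroˡ V))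
             (≈ᴹ.trans (≈ᴹ.sym (⊗-assoc (rowsOf (I C)) X′ V)) (≈ᴹ.trans (⊗-cong I-rows≈V ≈ᴹ.refl) B⊗V≈𝟏))

  inv-det : ∀ {n} (f : Formula n n) {B} → Represents (construct f) B → det (N (construct (inv f))) ≈ det (N (construct f)) * det B
  inv-det f {B} rep = det-block-schurˡ (neg X′) B
    (≈ᴹ.sym (≈ᴹ.trans (⊗-negʳ (N (construct f)) X′) (neg-cong N⊗X≈J)))
    (≈ᴹ.trans (⊕-cong (⊗-negʳ (rowsOf (I (construct f))) X′) ≈ᴹ.refl) (⊕-cancel I-rows≈V))
    where open Represents rep renaming (X to X′)

  -- The columns of the last block of N are ordered (m_w, n_w) as in the paper but indexed
  -- through a cast from Fin (n + m); this turns the lower right corner into the block-swap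
  -- permutation K, whose determinant is ±1.
  module AddBlock {n m} (s : Carrier) (L R : Construction n m) where

    n+m≡m+n : n +ℕ m ≡ m +ℕ n
    n+m≡m+n = ℕ.+-comm n m

    sL sR : ℕ
    sL = size L
    sR = size R

    EL : Matrix sL m
    EL = colsOf (J L)
    sER : Matrix sR m
    sER = scale s (colsOf (J R))
    K₁ : Matrix n (n +ℕ m)
    K₁ = castCols n+m≡m+n (hcat (𝟎 {n} {m}) 𝟏)
    K₂ : Matrix m (n +ℕ m)
    K₂ = castCols n+m≡m+n (hcat 𝟏 (𝟎 {m} {n}))
    K : Matrix (n +ℕ m) (n +ℕ m)
    K = vcat K₁ K₂
    B₁ : Matrix sL (sR +ℕ (n +ℕ m))
    B₁ = hcat (𝟎 {sL} {sR}) (castCols n+m≡m+n (hcat EL (𝟎 {sL} {n})))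
    C₁ : Matrix (sR +ℕ (n +ℕ m)) sL
    C₁ = vcat (𝟎 {sR} {sL}) (vcat (rowsOf (I L)) (𝟎 {m} {sL}))
    B₂ : Matrix sR (n +ℕ m)
    B₂ = castCols n+m≡m+n (hcat sER (𝟎 {sR} {n}))
    C₂ : Matrix (n +ℕ m) sR
    C₂ = vcat (rowsOf (I R)) (𝟎 {m} {sR})
    D₁ : Matrix (sR +ℕ (n +ℕ m)) (sR +ℕ (n +ℕ m))
    D₁ = block (N R) B₂ C₂ K

    N≈block : N (addBlock s L R) ≈ᴹ block (N L) B₁ C₁ D₁
    N≈block = vcat-cong (castCols-hcat₂ eq n+m≡m+n (N L) (𝟎 {sL} {sR}) (hcat EL (𝟎 {sL} {n})))
      (≈ᴹ.trans (vcat-cong (castCols-hcat₂ eq n+m≡m+n (𝟎 {sR} {sL}) (N R) (hcat sER (𝟎 {sR} {n})))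
                  (vcat-cong (castCols-hcat₂ eq n+m≡m+n (rowsOf (I L)) (rowsOf (I R)) (hcat (𝟎 {n} {m}) 𝟏))
                             (castCols-hcat₂ eq n+m≡m+n (𝟎 {m} {sL}) (𝟎 {m} {sR}) (hcat 𝟏 (𝟎 {m} {n})))))
      (≈ᴹ.trans (vcat-cong {A = hcat (𝟎 {sR} {sL}) (hcat (N R) B₂)} ≈ᴹ.refl
                  (vcat-hcat-interchange (rowsOf (I L)) (hcat (rowsOf (I R)) K₁) (𝟎 {m} {sL}) (hcat (𝟎 {m} {sR}) K₂)))
      (≈ᴹ.trans (vcat-hcat-interchange (𝟎 {sR} {sL}) (hcat (N R) B₂) (vcat (rowsOf (I L)) (𝟎 {m} {sL}))
                                       (vcat (hcat (rowsOf (I R)) K₁) (hcat (𝟎 {m} {sR}) K₂)))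
                (hcat-cong {A = C₁} ≈ᴹ.refl (vcat-cong {A = hcat (N R) B₂} ≈ᴹ.refl
                  (vcat-hcat-interchange (rowsOf (I R)) K₁ (𝟎 {m} {sR}) K₂))))))
      where
      eq : sL +ℕ (sR +ℕ (n +ℕ m)) ≡ sL +ℕ (sR +ℕ (m +ℕ n))
      eq = ≡.cong (λ t → sL +ℕ (sR +ℕ t)) n+m≡m+n

    J-rows-annihilate : ∀ {r d} (E : Matrix r m) (P : Matrix n d) → (hcat (𝟎 {r} {n}) E ⊗ vcat P 𝟎) ≈ᴹ 𝟎
    J-rows-annihilate E P = ≈ᴹ.trans (hcat-⊗-vcat 𝟎 E P 𝟎) (≈ᴹ.trans (⊕-identityˡ (⊗-zeroˡ P)) (⊗-zeroʳ E))

    J-rows-select : ∀ {r} (E : Matrix r m) → (hcat (𝟎 {r} {n}) E ⊗ K) ≈ᴹ castCols n+m≡m+n (hcat E 𝟎)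
    J-rows-select {r} E = castCols-cong n+m≡m+n (≈ᴹ.trans (hcat-⊗-vcat (𝟎 {r} {n}) E (hcat (𝟎 {n} {m}) 𝟏) (hcat 𝟏 (𝟎 {m} {n})))
      (≈ᴹ.trans (⊕-identityˡ (⊗-zeroˡ (hcat (𝟎 {n} {m}) 𝟏)))
                (≈ᴹ.trans (⊗-hcat E 𝟏 (𝟎 {m} {n})) (hcat-cong (⊗-identityʳ E) (⊗-zeroʳ E)))))

    det-D₁ : det D₁ ≈ det (N R) * det K
    det-D₁ = det-block-schurʳ (hcat 𝟎 sER) (N R) (≈ᴹ.sym (J-rows-select sER))
                              (⊕-identityʳ (J-rows-annihilate sER (rowsOf (I R))))

    det-N : det (N (addBlock s L R)) ≈± det (N L) * det (N R)
    det-N = ≈±-trans (inj₁ (begin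
      det (N (addBlock s L R))            ≈⟨ det-cong N≈block ⟩
      det (block (N L) B₁ C₁ D₁)          ≈⟨ det-block-schurʳ Y (N L) (≈ᴹ.sym Y⊗D₁≈B₁) (⊕-identityʳ Y⊗C₁≈𝟎) ⟩
      det (N L) * det D₁                  ≈⟨ *-congˡ det-D₁ ⟩
      det (N L) * (det (N R) * det K)     ≈⟨ *-assoc _ _ _ ⟨
      det (N L) * det (N R) * det K       ∎))
      (≈±-trans (*-≈± (inj₁ refl) (det-blockSwap n m)) (inj₁ (*-identityʳ _)))
      where
      Y : Matrix sL (sR +ℕ (n +ℕ m))
      Y = hcat (𝟎 {sL} {sR}) (hcat (𝟎 {sL} {n}) EL)
      Y⊗D₁≈B₁ : (Y ⊗ D₁) ≈ᴹ B₁
      Y⊗D₁≈B₁ = ≈ᴹ.trans (hcat-⊗-vcat (𝟎 {sL} {sR}) (hcat 𝟎 EL) (hcat (N R) B₂) (hcat C₂ K))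
        (≈ᴹ.trans (⊕-identityˡ (⊗-zeroˡ (hcat (N R) B₂)))
        (≈ᴹ.trans (⊗-hcat (hcat 𝟎 EL) C₂ K) (hcat-cong (J-rows-annihilate EL (rowsOf (I R))) (J-rows-select EL))))
      Y⊗C₁≈𝟎 : (Y ⊗ C₁) ≈ᴹ 𝟎
      Y⊗C₁≈𝟎 = ≈ᴹ.trans (hcat-⊗-vcat (𝟎 {sL} {sR}) (hcat 𝟎 EL) (𝟎 {sR} {sL}) (vcat (rowsOf (I L)) 𝟎))
        (≈ᴹ.trans (⊕-identityˡ (⊗-zeroˡ {sL} {sR} {sL} 𝟎)) (J-rows-annihilate EL (rowsOf (I L))))

    represents : ∀ {VL VR V} → Represents L VL → Represents R VR → V ≈ᴹ (VL ⊕ scale s VR) → Represents (addBlock s L R) V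
    represents {VL} {VR} {V} repL repR V≈ = record
      { X        = vcat (neg XL) X₂
      ; N⊗X≈J    = ≈ᴹ.trans (⊗-cong N≈block ≈ᴹ.refl) (≈ᴹ.trans (block-⊗-vcat (N L) B₁ C₁ D₁ (neg XL) X₂)
                   (≈ᴹ.trans (vcat-cong top bottom) (≈ᴹ.sym J-columns)))
      ; I-rows≈V = ≈ᴹ.trans (rowsOf-↑ʳ-⊗-vcat (λ i → sR ↑ʳ I-position i) (neg XL) X₂)
                   (≈ᴹ.trans (rowsOf-↑ʳ-⊗-vcat I-position (neg (scale s XR)) W)
                   (≈ᴹ.trans (rowsOf-⊗ I-position W) (λ i j → reflexive (≡.trans
                     (≡.cong (λ k → vcat 𝟏 V k j) (cast-involutive n+m≡m+n (ℕ.+-comm m n) (m ↑ʳ i))) (vcat-↑ʳ 𝟏 V i j)))))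
      }
      where
      open Represents repL renaming (X to XL; N⊗X≈J to NL⊗XL≈J; I-rows≈V to IL-rows≈VL)
      open Represents repR renaming (X to XR; N⊗X≈J to NR⊗XR≈J; I-rows≈V to IR-rows≈VR)
      I-position : Fin n → Fin (n +ℕ m)
      I-position i = cast (ℕ.+-comm m n) (m ↑ʳ i)
      W : Matrix (n +ℕ m) m
      W = castRows n+m≡m+n (vcat 𝟏 V)
      X₂ : Matrix (sR +ℕ (n +ℕ m)) m
      X₂ = vcat (neg (scale s XR)) W
      selects : ∀ {r} (E : Matrix r m) → (castCols n+m≡m+n (hcat E (𝟎 {r} {n})) ⊗ W) ≈ᴹ E
      selects E = ≈ᴹ.trans (castCols-⊗-castRows n+m≡m+n (hcat E 𝟎) (vcat 𝟏 V))
                  (≈ᴹ.trans (hcat-⊗-vcat E 𝟎 𝟏 V) (≈ᴹ.trans (⊕-identityʳ (⊗-zeroˡ V)) (⊗-identityʳ E)))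
      K⊗W : (K ⊗ W) ≈ᴹ vcat V 𝟏
      K⊗W = ≈ᴹ.trans (castCols-⊗-castRows n+m≡m+n (block (𝟎 {n} {m}) 𝟏 𝟏 (𝟎 {m} {n})) (vcat 𝟏 V))
            (≈ᴹ.trans (block-⊗-vcat (𝟎 {n} {m}) 𝟏 𝟏 (𝟎 {m} {n}) 𝟏 V)
            (vcat-cong (≈ᴹ.trans (⊕-identityˡ (⊗-zeroˡ {n} (𝟏 {m}))) (⊗-identityˡ V))
                       (≈ᴹ.trans (⊕-identityʳ (⊗-zeroˡ {m} V)) (⊗-identityˡ 𝟏))))
      top : ((N L ⊗ neg XL) ⊕ (B₁ ⊗ X₂)) ≈ᴹ 𝟎
      top = ≈ᴹ.trans (⊕-cong (≈ᴹ.trans (⊗-negʳ (N L) XL) (neg-cong NL⊗XL≈J))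
                             (≈ᴹ.trans (hcat-⊗-vcat (𝟎 {sL} {sR}) (castCols n+m≡m+n (hcat EL (𝟎 {sL} {n}))) (neg (scale s XR)) W)
                                       (≈ᴹ.trans (⊕-identityˡ (⊗-zeroˡ {sL} (neg (scale s XR)))) (selects EL))))
                     (⊕-cancel ≈ᴹ.refl)
      D₁⊗X₂ : (D₁ ⊗ X₂) ≈ᴹ vcat (𝟎 {sR}) (vcat (neg (scale s VR) ⊕ V) 𝟏)
      D₁⊗X₂ = ≈ᴹ.trans (block-⊗-vcat (N R) B₂ C₂ K (neg (scale s XR)) W) (vcat-cong
        (≈ᴹ.trans (⊕-cong (≈ᴹ.trans (⊗-negʳ (N R) (scale s XR)) (neg-cong (≈ᴹ.trans (⊗-scaleʳ s (N R) XR) (scale-cong s NR⊗XR≈J))))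
                          (selects sER))
                  (⊕-cancel ≈ᴹ.refl))
        (≈ᴹ.trans (⊕-cong (≈ᴹ.trans (vcat-⊗ (rowsOf (I R)) (𝟎 {m} {sR}) (neg (scale s XR)))
                            (vcat-cong (≈ᴹ.trans (⊗-negʳ (rowsOf (I R)) (scale s XR))
                                                 (neg-cong (≈ᴹ.trans (⊗-scaleʳ s (rowsOf (I R)) XR) (scale-cong s IR-rows≈VR))))
                                       (⊗-zeroˡ {m} (neg (scale s XR)))))
                          K⊗W)
                  (≈ᴹ.trans (vcat-⊕ (neg (scale s VR)) V (𝟎 {m} {m}) 𝟏) (vcat-cong {a = n} ≈ᴹ.refl (⊕-identityˡ (λ _ _ → refl))))))
      bottom : ((C₁ ⊗ neg XL) ⊕ (D₁ ⊗ X₂)) ≈ᴹ vcat (𝟎 {sR}) (vcat (𝟎 {n}) 𝟏)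
      bottom = ≈ᴹ.trans (⊕-cong (≈ᴹ.trans (vcat-⊗ (𝟎 {sR} {sL}) (vcat (rowsOf (I L)) (𝟎 {m} {sL})) (neg XL))
                                  (vcat-cong (⊗-zeroˡ {sR} (neg XL)) (≈ᴹ.trans (vcat-⊗ (rowsOf (I L)) (𝟎 {m} {sL}) (neg XL))
                                    (vcat-cong (≈ᴹ.trans (⊗-negʳ (rowsOf (I L)) XL) (neg-cong IL-rows≈VL)) (⊗-zeroˡ {m} (neg XL))))))
                                D₁⊗X₂)
               (≈ᴹ.trans (vcat-⊕ (𝟎 {sR} {m}) 𝟎 (vcat (neg VL) 𝟎) (vcat (neg (scale s VR) ⊕ V) 𝟏))
               (vcat-cong {a = sR} (⊕-identityˡ (λ _ _ → refl))
               (≈ᴹ.trans (vcat-⊕ (neg VL) (neg (scale s VR) ⊕ V) (𝟎 {m} {m}) 𝟏)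
                         (vcat-cong {a = n} (λ i j → V-cancels (V≈ i j)) (⊕-identityˡ (λ _ _ → refl))))))
        where
        V-cancels : ∀ {a b v} → v ≈ a + b → - a + (- b + v) ≈ 0#
        V-cancels {a} {b} {v} v≈a+b = begin
          - a + (- b + v)       ≈⟨ +-congˡ (+-congˡ v≈a+b) ⟩
          - a + (- b + (a + b)) ≈⟨ +-congˡ (+-congˡ (+-comm a b)) ⟩
          - a + (- b + (b + a)) ≈⟨ +-congˡ (+-assoc (- b) b a) ⟨
          - a + ((- b + b) + a) ≈⟨ +-congˡ (+-congʳ (-‿inverseˡ b)) ⟩
          - a + (0# + a)        ≈⟨ +-congˡ (+-identityˡ a) ⟩
          - a + a               ≈⟨ -‿inverseˡ a ⟩
          0#                    ∎
      J-columns : colsOf (J (addBlock s L R)) ≈ᴹ vcat (𝟎 {sL}) (vcat (𝟎 {sR}) (vcat (𝟎 {n}) 𝟏))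
      J-columns = ≈ᴹ.trans (colsOf-↑ʳ sL (λ j → sR ↑ʳ (n ↑ʳ j)))
                  (vcat-cong {a = sL} ≈ᴹ.refl (≈ᴹ.trans (colsOf-↑ʳ sR (λ j → n ↑ʳ j))
                                                         (vcat-cong {a = sR} ≈ᴹ.refl (colsOf-↑ʳ n (λ j → j)))))

  represents : ∀ {n m} {f : Formula n m} {V} → Eval f V → Represents (construct f) V
  represents (input A)                 = input-represents A
  represents (inv {f = f} e B⊗V≈𝟏 _)   = inv-represents f (represents e) B⊗V≈𝟏
  represents (add {f = f} {g} e e′)    = AddBlock.represents 1# (construct f) (construct g) (represents e) (represents e′)
                                           (λ i j → +-congˡ (sym (*-identityˡ _)))
  represents (sub {f = f} {g} e e′)    = AddBlock.represents (- 1#) (construct f) (construct g) (represents e) (represents e′)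
                                           (λ i j → +-congˡ (sym (-1*x≈-x _)))
  represents (mul {f = f} {g} e e′)    = mul-represents f g (represents e) (represents e′)

  det-construct : ∀ {n m} {f : Formula n m} {V} (e : Eval f V) → det (N (construct f)) ≈± invDetProd e
  det-construct (input A)              = input-det A
  det-construct (inv {f = f} e _ _)    = ≈±-respˡ (inv-det f (represents e))
                                           (≈±-trans (*-≈± (det-construct e) (inj₁ refl)) (inj₁ (*-comm _ _)))
  det-construct (add {f = f} {g} e e′) = ≈±-trans (AddBlock.det-N 1# (construct f) (construct g))
                                                  (*-≈± (det-construct e) (det-construct e′))
  det-construct (sub {f = f} {g} e e′) = ≈±-trans (AddBlock.det-N (- 1#) (construct f) (construct g))
                                                  (*-≈± (det-construct e) (det-construct e′))
  det-construct (mul {f = f} {g} e e′) = ≈±-respˡ (mul-det f g) (*-≈± (det-construct e) (det-construct e′))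

lemma4p4 : ∀ {c ℓ : Level} (R : CommutativeRing c ℓ) →
    let open CommutativeRing R
        open MatrixFormulas R
    in ∀ {n m : ℕ} (f : Formula n m) (V : Matrix n m) (e : Eval f V) →
       (det (Construction.N (construct f)) ≈ invDetProd e)
         ⊎ (det (Construction.N (construct f)) ≈ - invDetProd e)
lemma4p4 R f V e = FormulaDeterminant.det-construct R e
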